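{- The following are equivalent: (i) $\mathcal{V}$ admits right uniform Maehara interpolation. (ii) $\mathcal{V}$ admits right uniform deductive interpolation and has the congruence extension property. (iii) $\mathcal{V}$ has the amalgamation property and the congruence extension property, and the compact lifting of any homomorphism between finitely presented algebras in $\mathcal{V}$ has a right adjoint.
   Context: Fix an algebraic signature $\mathcal{L}$ containing at least one constant symbol and a variety $\mathcal{V}$ of $\mathcal{L}$-algebras. $\mathbf{F}(\overline{x})$ is the free algebra of $\mathcal V$ on variables $\overline{x}$; distinct letters $\overline{x},\overline{y},\overline{z}$ denote pairwise disjoint sets of variables. $\Sigma(\overline{x})$ means all variables of the set of equations $\Sigma$ lie in $\overline{x}$; $\Sigma\models_{\mathcal V}\Delta$ means every assignment in every member of $\mathcal V$ satisfying all equations of $\Sigma$ satisfies all of $\Delta$; $\Gamma,\Sigma\models_{\mathcal V}\Delta$ means $\Gamma\cup\Sigma\models_{\mathcal V}\Delta$. Right uniform deductive interpolation: for any finite $\overline{x},\overline{y}$ and finite $\Sigma(\overline{x},\overline{y})$ there is a finite $\Pi(\overline{y})$ with $\Sigma\models_{\mathcal V}\Pi$ and, for every equation $\varepsilon(\overline{y},\overline{z})$, $\Sigma\models_{\mathcal V}\varepsilon$ implies $\Pi\models_{\mathcal V}\varepsilon$. Right uniform Maehara interpolation: for any finite $\overline{x},\overline{y}$ and finite $\Gamma(\overline{x},\overline{y})$ there is a finite $\Pi(\overline{y})$ such that for all finite sets of equations $\Sigma(\overline{y},\overline{z}),\Delta(\overline{y},\overline{z})$: $\Gamma,\Sigma\models_{\mathcal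 V}\Delta \iff \Pi,\Sigma\models_{\mathcal V}\Delta$. Amalgamation property: for all $\mathbf A,\mathbf B,\mathbf C\in\mathcal V$ and embeddings $i\colon\mathbf A\to\mathbf B$, $j\colon\mathbf A\to\mathbf C$ there are $\mathbf D\in\mathcal V$ and embeddings $h\colon\mathbf B\to\mathbf D$, $k\colon\mathbf C\to\mathbf D$ with $hi=kj$. Congruence extension property: every congruence of a subalgebra of any $\mathbf A\in\mathcal V$ is the restriction of a congruence of $\mathbf A$. For a homomorphism $h\colon\mathbf A\to\mathbf B$, the compact lifting of $h$ is the map from the join-semilattice $\mathrm{KCon}\,\mathbf A$ of compact (finitely generated) congruences of $\mathbf A$ (ordered by inclusion) to $\mathrm{KCon}\,\mathbf B$ sending $\psi$ to the congruence generated by $\{(h(a),h(a')):(a,a')\in\psi\}$. A map $f\colon P\to Q$ of posets has a right adjoint $g$ if $f(a)\le b\iff a\le g(b)$. $\mathbf A$ is finitely presented if there is a surjective homomorphism $p\colon\mathbf F(\overline{x})\to\mathbf A$ with $\overline{x}$ finite and $\ker p$ compact. -}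

module Defs where

open import Data.Nat using (ℕ)
open import Data.Fin using (Fin)
open import Data.Product using (Σ; Σ-syntax; _×_; _,_; proj₁; proj₂)
open import Data.Sum using (_⊎_; inj₁; inj₂; [_,_])
open import Data.List using (List; []; _∷_; map; _++_)
open import Data.List.Relation.Unary.All using (All)
open import Data.List.Membership.Propositional using (_∈_)
open import Relation.Binary.PropositionalEquality using (_≡_)
open import Relation.Binary.Structures using (IsEquivalence)
open import Function using (_∘_)
open import Function.Bundles using (_⇔_)

record Signature : Set₁ where
  field
    Op    : Set
    arity : Op → ℕ

open Signature public

HasConstant : Signature → Set
HasConstant S = Σ (Op S) (λ f → arity S f ≡ 0)

module _ (S : Signature) where

  data Term (X : Set) : Set where
    var : X → Term X
    app : (f : Op S) → (Fin (arity S f) → Term X) → Term X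

  Eqn : Set → Set
  Eqn X = Term X × Term X

  Theory : Set₁
  Theory = Term ℕ → Term ℕ → Set

  ren : {X Y : Set} → (X → Y) → Term X → Term Y
  ren f (var x)    = var (f x)
  ren f (app g ts) = app g (λ i → ren f (ts i))

  sub : {X Y : Set} → (X → Term Y) → Term X → Term Y
  sub σ (var x)    = σ x
  sub σ (app g ts) = app g (λ i → sub σ (ts i))

  renEq : {X Y : Set} → (X → Y) → Eqn X → Eqn Y
  renEq f (s , t) = ren f s , ren f t

  renEqs : {X Y : Set} → (X → Y) → List (Eqn X) → List (Eqn Y)
  renEqs f = map (renEq f)

  record Algebra : Set₁ where
    field
      Carrier : Set
      _≈_     : Carrier → Carrier → Set
      isEquiv : IsEquivalence _≈_
      op      : (f : Op S) → (Fin (arity S f) → Carrier) → Carrier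
      op-cong : ∀ f {as bs : Fin (arity S f) → Carrier} →
                (∀ i → as i ≈ bs i) → op f as ≈ op f bs

  open Algebra public

  eval : (A : Algebra) {X : Set} → (X → Carrier A) → Term X → Carrier A
  eval A ρ (var x)    = ρ x
  eval A ρ (app f ts) = op A f (λ i → eval A ρ (ts i))

  Holds : (A : Algebra) {X : Set} → (X → Carrier A) → Eqn X → Set
  Holds A ρ (s , t) = _≈_ A (eval A ρ s) (eval A ρ t)

  record Hom (A B : Algebra) : Set where
    field
      fun      : Carrier A → Carrier B
      fun-cong : ∀ {a a'} → _≈_ A a a' → _≈_ B (fun a) (fun a')
      preserve : ∀ f (as : Fin (arity S f) → Carrier A) →
                 _≈_ B (fun (op A f as)) (op B f (λ i → fun (as i)))

  open Hom public

  record Emb (A B : Algebra) : Set where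
    field
      hom       : Hom A B
      injective : ∀ {a a'} → _≈_ B (fun hom a) (fun hom a') → _≈_ A a a'

  open Emb public

  Surjective : {A B : Algebra} → Hom A B → Set
  Surjective {A} {B} h = ∀ (b : Carrier B) → Σ (Carrier A) (λ a → _≈_ B (fun h a) b)

  record Congruence (A : Algebra) : Set₁ where
    field
      rel      : Carrier A → Carrier A → Set
      isEquivR : IsEquivalence rel
      ≈⊆rel    : ∀ {a b} → _≈_ A a b → rel a b
      compat   : ∀ f {as bs : Fin (arity S f) → Carrier A} →
                 (∀ i → rel (as i) (bs i)) → rel (op A f as) (op A f bs)

  open Congruence public

  _⊆_ : {C : Set} → (C → C → Set) → (C → C → Set) → Set
  R ⊆ R' = ∀ {a b} → R a b → R' a b

  data Cg (A : Algebra) (P : Carrier A → Carrier A → Set) : Carrier A → Carrier A → Set where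
    cg-base   : ∀ {a b} → P a b → Cg A P a b
    cg-incl   : ∀ {a b} → _≈_ A a b → Cg A P a b
    cg-sym   : ∀ {a b} → Cg A P a b → Cg A P b a
    cg-trans  : ∀ {a b c} → Cg A P a b → Cg A P b c → Cg A P a c
    cg-compat : ∀ f {as bs : Fin (arity S f) → Carrier A} →
             (∀ i → Cg A P (as i) (bs i)) → Cg A P (op A f as) (op A f bs)

  ListRel : {C : Set} → List (C × C) → C → C → Set
  ListRel L a b = (a , b) ∈ L

  IsCompact : (A : Algebra) → (Carrier A → Carrier A → Set) → Set
  IsCompact A R = Σ (List (Carrier A × Carrier A)) λ L →
    ∀ a b → (R a b → Cg A (ListRel L) a b) × (Cg A (ListRel L) a b → R a b)

  KCon : Algebra → Set₁
  KCon A = Σ (Congruence A) (λ θ → IsCompact A (rel θ))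

  ImageRel : {A B : Algebra} → Hom A B → (Carrier A → Carrier A → Set) →
             Carrier B → Carrier B → Set
  ImageRel {A} h R b b' =
    Σ (Carrier A) λ a → Σ (Carrier A) λ a' → R a a' × (fun h a ≡ b) × (fun h a' ≡ b')

  liftRel : {A B : Algebra} → Hom A B → KCon A → Carrier B → Carrier B → Set
  liftRel {A} {B} h ψ = Cg B (ImageRel h (rel (proj₁ ψ)))

  LiftingHasRightAdjoint : {A B : Algebra} → Hom A B → Set₁
  LiftingHasRightAdjoint {A} {B} h =
    Σ (KCon B → KCon A) λ g → ∀ (ψ : KCon A) (φ : KCon B) →
      (liftRel h ψ ⊆ rel (proj₁ φ)) ⇔ (rel (proj₁ ψ) ⊆ rel (proj₁ (g φ)))

  record SubUniverse (A : Algebra) : Set₁ where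
    field
      pred   : Carrier A → Set
      closed : ∀ f (as : Fin (arity S f) → Carrier A) →
               (∀ i → pred (as i)) → pred (op A f as)

  open SubUniverse public

  SubAlg : (A : Algebra) → SubUniverse A → Algebra
  SubAlg A U = record
    { Carrier = Σ (Carrier A) (pred U)
    ; _≈_     = λ a b → _≈_ A (proj₁ a) (proj₁ b)
    ; isEquiv = record { refl = IsEquivalence.refl (isEquiv A)
                       ; sym = IsEquivalence.sym (isEquiv A)
                       ; trans = IsEquivalence.trans (isEquiv A) }
    ; op      = λ f as → op A f (λ i → proj₁ (as i)) , closed U f _ (λ i → proj₂ (as i))
    ; op-cong = λ f eq → op-cong A f eq
    }

  module Variety (E : Theory) where

    InV : Algebra → Set
    InV A = ∀ {s t} → E s t → (ρ : ℕ → Carrier A) → _≈_ A (eval A ρ s) (eval A ρ t)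

    _⊨_ : {X : Set} → List (Eqn X) → List (Eqn X) → Set₁
    _⊨_ {X} Γ Δ = (A : Algebra) → InV A → (ρ : X → Carrier A) →
                  All (Holds A ρ) Γ → All (Holds A ρ) Δ

    data Deriv {X : Set} : Term X → Term X → Set where
      ax    : ∀ {s t} → E s t → (σ : ℕ → Term X) → Deriv (sub σ s) (sub σ t)
      refl  : ∀ {t} → Deriv t t
      symm  : ∀ {s t} → Deriv s t → Deriv t s
      trans : ∀ {s t u} → Deriv s t → Deriv t u → Deriv s u
      cong  : ∀ f {ts us : Fin (arity S f) → Term X} →
              (∀ i → Deriv (ts i) (us i)) → Deriv (app f ts) (app f us)

    Free : Set → Algebra
    Free X = record
      { Carrier = Term X
      ; _≈_     = Deriv
      ; isEquiv = record { refl = refl ; sym = symm ; trans = trans }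
      ; op      = app
      ; op-cong = cong
      }

    FinitelyPresented : Algebra → Set
    FinitelyPresented A = Σ ℕ λ n → Σ (Hom (Free (Fin n)) A) λ p →
      Surjective p × IsCompact (Free (Fin n)) (λ s t → _≈_ A (fun p s) (fun p t))

    -- variable contexts: x̄ = Fin n, ȳ = Fin m, z̄ = Fin k
    Ctx : ℕ → ℕ → ℕ → Set
    Ctx n m k = (Fin n ⊎ Fin m) ⊎ Fin k

    yz↪ : ∀ {n m k} → Fin m ⊎ Fin k → Ctx n m k
    yz↪ = [ inj₁ ∘ inj₂ , inj₂ ]

    RightUniformDeductiveInterpolation : Set₁
    RightUniformDeductiveInterpolation =
      ∀ n m (Γ : List (Eqn (Fin n ⊎ Fin m))) →
      Σ[ Π ∈ List (Eqn (Fin m)) ]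
        (Γ ⊨ renEqs inj₂ Π) ×
        (∀ k (ε : Eqn (Fin m ⊎ Fin k)) →
           renEqs (inj₁ {B = Fin k}) Γ ⊨ (renEq (yz↪ {n}) ε ∷ []) →
           renEqs (inj₁ {B = Fin k}) Π ⊨ (ε ∷ []))

    RightUniformMaeharaInterpolation : Set₁
    RightUniformMaeharaInterpolation =
      ∀ n m (Γ : List (Eqn (Fin n ⊎ Fin m))) →
      Σ[ Π ∈ List (Eqn (Fin m)) ]
        (∀ k (Σ' Δ : List (Eqn (Fin m ⊎ Fin k))) →
           ((renEqs (inj₁ {B = Fin k}) Γ ++ renEqs (yz↪ {n}) Σ') ⊨ renEqs (yz↪ {n}) Δ)
           ⇔ ((renEqs (inj₁ {B = Fin k}) Π ++ Σ') ⊨ Δ))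

    AmalgamationProperty : Set₁
    AmalgamationProperty =
      ∀ (A B C : Algebra) → InV A → InV B → InV C →
      (i : Emb A B) (j : Emb A C) →
      Σ[ D ∈ Algebra ] InV D × Σ[ h ∈ Emb B D ] Σ[ k ∈ Emb C D ]
        (∀ a → _≈_ D (fun (hom h) (fun (hom i) a)) (fun (hom k) (fun (hom j) a)))

    CongruenceExtensionProperty : Set₁
    CongruenceExtensionProperty =
      ∀ (A : Algebra) → InV A → (U : SubUniverse A) (θ : Congruence (SubAlg A U)) →
      Σ[ Φ ∈ Congruence A ] (∀ (a b : Carrier (SubAlg A U)) →
        rel θ a b ⇔ rel Φ (proj₁ a) (proj₁ b))

    CompactLiftingsHaveRightAdjoints : Set₁
    CompactLiftingsHaveRightAdjoints =
      ∀ (A B : Algebra) → InV A → InV B → FinitelyPresented A → FinitelyPresented B →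
      (h : Hom A B) → LiftingHasRightAdjoint h

module Submission where

-- (i) ⇒ (ii): with Σ empty, a Maehara interpolant is a uniform deductive interpolant. For the
-- congruence extension property, extend θ on a subalgebra by the congruence it generates; a pair of
-- the subalgebra in the extension is witnessed by finitely many elements and equations, to which
-- Maehara interpolation over the subalgebra elements applies.
-- (ii) ⇒ (i): in F(x̄ȳz̄)/Γ, the kernel of the map from the subalgebra generated by ȳz̄ onto
-- F(ȳz̄)/(Π, Σ) is well defined by uniformity; its extension contains Γ and Σ.
-- (i) ⇒ amalgamation: amalgamate B and C over A by the algebra presented by their diagrams glued
-- along A. An identification of two elements of C in it involves finitely many elements of B, A
-- and C, and the interpolant over the A-elements of the B-side equations transfers it to C.
-- (ii) ⇒ adjoints: with x̄ generating B and ȳ generating A, g φ is generated by the uniform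
-- interpolant over ȳ of the relations of B, the equations ȳ = h(ȳ) written in x̄, and φ.
-- (iii) ⇒ (ii): the generators Π of g(0), for g right adjoint to the lifting of F(ȳ) → F(x̄ȳ)/Γ,
-- interpolate Γ; F(ȳ)/Π embeds into F(x̄ȳ)/Γ and into F(ȳz̄)/Π, and an amalgam of the two
-- carries consequences of Γ to consequences of Π.

open import Defs
open import Data.Nat using (ℕ; zero; suc; _+_; _⊔_; _≤_; _<_)
open import Data.Nat.Properties using (m≤m⊔n; m≤n⊔m; ≤-trans; n≤1+n; _<?_)
open import Data.Empty using (⊥-elim)
open import Data.Fin using (Fin; zero; suc; toℕ; fromℕ<; join; splitAt; _↑ˡ_; _↑ʳ_)
open import Data.Fin.Properties using (toℕ-fromℕ<; splitAt-join)
open import Data.Product using (Σ; Σ-syntax; _×_; _,_; proj₁; proj₂)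
open import Data.Sum using (_⊎_; inj₁; inj₂; [_,_]; [_,_]′; swap)
open import Data.Sum.Properties using (inj₁-injective; inj₂-injective)
import Data.Sum as Sum
open import Data.List using (List; []; _∷_; map; _++_; concat; tabulate)
open import Data.List.Relation.Unary.All as All using (All; []; _∷_)
import Data.List.Relation.Unary.All.Properties as All
open import Data.List.Relation.Unary.Any using (here)
open import Data.List.Membership.Propositional using (_∈_)
open import Data.List.Membership.Propositional.Properties using (∈-++⁺ˡ; ∈-++⁺ʳ; ∈-++⁻; ∈-map⁺; ∈-map⁻)
import Data.Vec.Functional as Vec
open import Data.Vec.Functional.Properties using (lookup-++ˡ; lookup-++ʳ)
open import Relation.Nullary using (yes; no)
open import Relation.Binary.Bundles using (Setoid)
open import Relation.Binary.PropositionalEquality as ≡ using (_≡_)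
open import Relation.Binary.Structures using (IsEquivalence)
open import Function using (_∘_; id)
open import Function.Bundles using (_⇔_; mk⇔; Equivalence)
open Equivalence using (to; from)

module _ {C : Set} (_≼_ : C → C → Set₁) (≼-trans : ∀ {a b c} → a ≼ b → b ≼ c → a ≼ c)
         (⊥ : C) (merge : ∀ a b → Σ[ c ∈ C ] (a ≼ c × b ≼ c)) where

  finite-upper-bound : ∀ k (cs : Fin k → C) → Σ[ c ∈ C ] (∀ i → cs i ≼ c)
  finite-upper-bound zero    cs = ⊥ , λ ()
  finite-upper-bound (suc k) cs with finite-upper-bound k (cs ∘ suc)
  ... | c , cs≼c with merge (cs zero) c
  ...   | d , c₀≼d , c≼d = d , λ { zero → c₀≼d ; (suc i) → ≼-trans (cs≼c i) c≼d }

module Evaluation (S : Signature) where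

  module ≈ (A : Algebra S) = IsEquivalence (isEquiv A)

  setoid : Algebra S → Setoid _ _
  setoid A = record { Carrier = Carrier A ; _≈_ = _≈_ A ; isEquivalence = isEquiv A }

  ≡⇒≈ : (A : Algebra S) {a b : Carrier A} → a ≡ b → _≈_ A a b
  ≡⇒≈ A ≡.refl = ≈.refl A

  constant : HasConstant S → (A : Algebra S) → Carrier A
  constant (c , c-nullary) A = op A c (Vec.[] ∘ ≡.subst Fin c-nullary)

  module _ (A : Algebra S) {X : Set} where

    eval-cong : {ρ ρ' : X → Carrier A} → (∀ x → _≈_ A (ρ x) (ρ' x)) →
                ∀ t → _≈_ A (eval S A ρ t) (eval S A ρ' t)
    eval-cong ρ≈ρ' (var x)    = ρ≈ρ' x
    eval-cong ρ≈ρ' (app f ts) = op-cong A f (λ i → eval-cong ρ≈ρ' (ts i))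

    eval-ren : {Y : Set} (ρ : Y → Carrier A) (f : X → Y) →
               ∀ t → _≈_ A (eval S A ρ (ren S f t)) (eval S A (ρ ∘ f) t)
    eval-ren ρ f (var x)    = ≈.refl A
    eval-ren ρ f (app g ts) = op-cong A g (λ i → eval-ren ρ f (ts i))

    eval-sub : {Y : Set} (ρ : Y → Carrier A) (σ : X → Term S Y) →
               ∀ t → _≈_ A (eval S A ρ (sub S σ t)) (eval S A (eval S A ρ ∘ σ) t)
    eval-sub ρ σ (var x)    = ≈.refl A
    eval-sub ρ σ (app g ts) = op-cong A g (λ i → eval-sub ρ σ (ts i))

    eval-hom : (B : Algebra S) (h : Hom S A B) (ρ : X → Carrier A) →
               ∀ t → _≈_ B (fun h (eval S A ρ t)) (eval S B (fun h ∘ ρ) t)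
    eval-hom B h ρ (var x)    = ≈.refl B
    eval-hom B h ρ (app g ts) =
      ≈.trans B (preserve h g _) (op-cong B g (λ i → eval-hom B h ρ (ts i)))

    holds-emb⁻ : (B : Algebra S) (h : Emb S A B) (ρ : X → Carrier A) →
                 ∀ e → Holds S B (fun (hom h) ∘ ρ) e → Holds S A ρ e
    holds-emb⁻ B h ρ (s , t) p =
      injective h (≈.trans B (eval-hom B (hom h) ρ s) (≈.trans B p (≈.sym B (eval-hom B (hom h) ρ t))))

    holds-cong : {ρ ρ' : X → Carrier A} → (∀ x → _≈_ A (ρ x) (ρ' x)) →
                 ∀ e → Holds S A ρ e → Holds S A ρ' e
    holds-cong ρ≈ρ' (s , t) p =
      ≈.trans A (≈.sym A (eval-cong ρ≈ρ' s)) (≈.trans A p (eval-cong ρ≈ρ' t))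

    All-holds-cong : {ρ ρ' : X → Carrier A} → (∀ x → _≈_ A (ρ x) (ρ' x)) →
                     ∀ Γ → All (Holds S A ρ) Γ → All (Holds S A ρ') Γ
    All-holds-cong ρ≈ρ' Γ = All.map (λ {e} → holds-cong ρ≈ρ' e)

    holds-hom : (B : Algebra S) (h : Hom S A B) (ρ : X → Carrier A) →
                ∀ e → Holds S A ρ e → Holds S B (fun h ∘ ρ) e
    holds-hom B h ρ (s , t) p =
      ≈.trans B (≈.sym B (eval-hom B h ρ s)) (≈.trans B (fun-cong h p) (eval-hom B h ρ t))

    module _ (U : SubUniverse S A) where

      eval-SubAlg : (ρ : X → Carrier (SubAlg S A U)) →
                    ∀ t → _≈_ A (proj₁ (eval S (SubAlg S A U) ρ t)) (eval S A (proj₁ ∘ ρ) t)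
      eval-SubAlg ρ (var x)    = ≈.refl A
      eval-SubAlg ρ (app f ts) = op-cong A f (λ i → eval-SubAlg ρ (ts i))

      holds-SubAlg : (ρ : X → Carrier (SubAlg S A U)) →
                     ∀ e → Holds S A (proj₁ ∘ ρ) e → Holds S (SubAlg S A U) ρ e
      holds-SubAlg ρ (s , t) p = ≈.trans A (eval-SubAlg ρ s) (≈.trans A p (≈.sym A (eval-SubAlg ρ t)))

    module _ {Y : Set} (ρ : Y → Carrier A) (f : X → Y) where

      holds-ren⁻ : ∀ e → Holds S A ρ (renEq S f e) → Holds S A (ρ ∘ f) e
      holds-ren⁻ (s , t) p = ≈.trans A (≈.sym A (eval-ren ρ f s)) (≈.trans A p (eval-ren ρ f t))

      holds-ren⁺ : ∀ e → Holds S A (ρ ∘ f) e → Holds S A ρ (renEq S f e)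
      holds-ren⁺ (s , t) p = ≈.trans A (eval-ren ρ f s) (≈.trans A p (≈.sym A (eval-ren ρ f t)))

      All-ren⁻ : ∀ Γ → All (Holds S A ρ) (renEqs S f Γ) → All (Holds S A (ρ ∘ f)) Γ
      All-ren⁻ Γ p = All.map (λ {e} → holds-ren⁻ e) (All.map⁻ p)

      All-ren⁺ : ∀ Γ → All (Holds S A (ρ ∘ f)) Γ → All (Holds S A ρ) (renEqs S f Γ)
      All-ren⁺ Γ p = All.map⁺ (All.map (λ {e} → holds-ren⁺ e) p)

module Congruences (S : Signature) where
  open Evaluation S

  module Con {A : Algebra S} (θ : Congruence S A) = IsEquivalence (isEquivR θ)

  _/_ : (A : Algebra S) → Congruence S A → Algebra S
  A / θ = record
    { Carrier = Carrier A
    ; _≈_     = rel θ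
    ; isEquiv = isEquivR θ
    ; op      = op A
    ; op-cong = compat θ
    }

  eval-/ : (A : Algebra S) (θ : Congruence S A) {X : Set} (ρ : X → Carrier A) →
           ∀ t → rel θ (eval S (A / θ) ρ t) (eval S A ρ t)
  eval-/ A θ ρ (var x)    = Con.refl θ
  eval-/ A θ ρ (app f ts) = compat θ f (λ i → eval-/ A θ ρ (ts i))

  holds-/ : (A : Algebra S) (θ : Congruence S A) {X : Set} (ρ : X → Carrier A) →
            ∀ s t → rel θ (eval S A ρ s) (eval S A ρ t) → Holds S (A / θ) ρ (s , t)
  holds-/ A θ ρ s t p = Con.trans θ (eval-/ A θ ρ s) (Con.trans θ p (Con.sym θ (eval-/ A θ ρ t)))

  holds-/⁺ : (A : Algebra S) (θ : Congruence S A) {X : Set} (ρ : X → Carrier A) →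
             ∀ e → Holds S A ρ e → Holds S (A / θ) ρ e
  holds-/⁺ A θ ρ (s , t) p = holds-/ A θ ρ s t (≈⊆rel θ p)

  ≈-congruence : (A : Algebra S) → Congruence S A
  ≈-congruence A = record
    { rel = _≈_ A ; isEquivR = isEquiv A ; ≈⊆rel = id ; compat = op-cong A }

  Cg-congruence : (A : Algebra S) (P : Carrier A → Carrier A → Set) → Congruence S A
  Cg-congruence A P = record
    { rel      = Cg S A P
    ; isEquivR = record { refl = cg-incl (≈.refl A) ; sym = cg-sym ; trans = cg-trans }
    ; ≈⊆rel    = cg-incl
    ; compat   = cg-compat
    }

  Cg-least-hom : (A B : Algebra S) (h : Hom S A B) {P : Carrier A → Carrier A → Set}
                 (θ : Congruence S B) → (∀ {a b} → P a b → rel θ (fun h a) (fun h b)) →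
                 ∀ {a b} → Cg S A P a b → rel θ (fun h a) (fun h b)
  Cg-least-hom A B h θ P⊆θ (cg-base p)      = P⊆θ p
  Cg-least-hom A B h θ P⊆θ (cg-incl a≈b)    = ≈⊆rel θ (fun-cong h a≈b)
  Cg-least-hom A B h θ P⊆θ (cg-sym d)       = Con.sym θ (Cg-least-hom A B h θ P⊆θ d)
  Cg-least-hom A B h θ P⊆θ (cg-trans d d')  =
    Con.trans θ (Cg-least-hom A B h θ P⊆θ d) (Cg-least-hom A B h θ P⊆θ d')
  Cg-least-hom A B h θ P⊆θ (cg-compat f ds) =
    Con.trans θ (≈⊆rel θ (preserve h f _))
      (Con.trans θ (compat θ f (λ i → Cg-least-hom A B h θ P⊆θ (ds i))) (≈⊆rel θ (≈.sym B (preserve h f _))))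

  id-hom : (A : Algebra S) → Hom S A A
  id-hom A = record { fun = id ; fun-cong = id ; preserve = λ f as → ≈.refl A }

  Cg-least : (A : Algebra S) {P : Carrier A → Carrier A → Set} (θ : Congruence S A) →
             (∀ {a b} → P a b → rel θ a b) → ∀ {a b} → Cg S A P a b → rel θ a b
  Cg-least A = Cg-least-hom A A (id-hom A)

  compactCongruence : (A : Algebra S) → List (Carrier A × Carrier A) → KCon S A
  compactCongruence A L = Cg-congruence A (ListRel S L) , L , λ a b → id , id

  module _ {A : Algebra S} (ψ : KCon S A) where

    generators : List (Carrier A × Carrier A)
    generators = proj₁ (proj₂ ψ)

    compact⇒Cg : ∀ {a b} → rel (proj₁ ψ) a b → Cg S A (ListRel S generators) a b
    compact⇒Cg = proj₁ (proj₂ (proj₂ ψ) _ _)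

    generator∈compact : ∀ {a b} → (a , b) ∈ generators → rel (proj₁ ψ) a b
    generator∈compact p = proj₂ (proj₂ (proj₂ ψ) _ _) (cg-base p)

  ≈-compact : (A : Algebra S) → KCon S A
  ≈-compact A = ≈-congruence A , [] , λ a b → cg-incl , Cg-least A (≈-congruence A) λ ()

  _∘ₕ_ : {A B C : Algebra S} → Hom S B C → Hom S A B → Hom S A C
  _∘ₕ_ {C = C} g f = record
    { fun      = fun g ∘ fun f
    ; fun-cong = fun-cong g ∘ fun-cong f
    ; preserve = λ o as → ≈.trans C (fun-cong g (preserve f o as)) (preserve g o (λ i → fun f (as i)))
    }

module EquationalLogic (S : Signature) (E : Theory S) where
  open Variety S E
  open Evaluation S
  open Congruences S

  deriv-sound : (A : Algebra S) → InV A → {X : Set} (ρ : X → Carrier A) →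
                ∀ {s t} → Deriv s t → _≈_ A (eval S A ρ s) (eval S A ρ t)
  deriv-sound A A∈V ρ (ax {s} {t} e σ) =
    ≈.trans A (eval-sub A ρ σ s) (≈.trans A (A∈V e (eval S A ρ ∘ σ)) (≈.sym A (eval-sub A ρ σ t)))
  deriv-sound A A∈V ρ refl           = ≈.refl A
  deriv-sound A A∈V ρ (symm d)       = ≈.sym A (deriv-sound A A∈V ρ d)
  deriv-sound A A∈V ρ (trans d d')   = ≈.trans A (deriv-sound A A∈V ρ d) (deriv-sound A A∈V ρ d')
  deriv-sound A A∈V ρ (cong f ds)    = op-cong A f (λ i → deriv-sound A A∈V ρ (ds i))

  Cg-sound : (A : Algebra S) → InV A → {X : Set} (ρ : X → Carrier A) {R : Term S X → Term S X → Set} →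
             (∀ {s t} → R s t → _≈_ A (eval S A ρ s) (eval S A ρ t)) →
             ∀ {s t} → Cg S (Free X) R s t → _≈_ A (eval S A ρ s) (eval S A ρ t)
  Cg-sound A A∈V ρ R⊆ker (cg-base r)      = R⊆ker r
  Cg-sound A A∈V ρ R⊆ker (cg-incl d)      = deriv-sound A A∈V ρ d
  Cg-sound A A∈V ρ R⊆ker (cg-sym d)       = ≈.sym A (Cg-sound A A∈V ρ R⊆ker d)
  Cg-sound A A∈V ρ R⊆ker (cg-trans d d')  =
    ≈.trans A (Cg-sound A A∈V ρ R⊆ker d) (Cg-sound A A∈V ρ R⊆ker d')
  Cg-sound A A∈V ρ R⊆ker (cg-compat f ds) = op-cong A f (λ i → Cg-sound A A∈V ρ R⊆ker (ds i))

  /-InV : (A : Algebra S) (θ : Congruence S A) → InV A → InV (A / θ)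
  /-InV A θ A∈V {s} {t} e ρ = holds-/ A θ ρ s t (≈⊆rel θ (A∈V e ρ))

  SubAlg-InV : (A : Algebra S) (U : SubUniverse S A) → InV A → InV (SubAlg S A U)
  SubAlg-InV A U A∈V {s} {t} e ρ = holds-SubAlg A U ρ (s , t) (A∈V e (proj₁ ∘ ρ))

  Presented : (X : Set) → (Term S X → Term S X → Set) → Algebra S
  Presented X R = Free X / Cg-congruence (Free X) R

  module _ {X : Set} where

    private
      eval-Free : {Y : Set} (ρ : Y → Term S X) → ∀ t → Deriv (eval S (Free X) ρ t) (sub S ρ t)
      eval-Free ρ (var y)    = refl
      eval-Free ρ (app f ts) = cong f (λ i → eval-Free ρ (ts i))

      sub-var : (t : Term S X) → Deriv (sub S var t) t
      sub-var (var x)    = refl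
      sub-var (app f ts) = cong f (λ i → sub-var (ts i))

    Free-InV : InV (Free X)
    Free-InV {s} {t} e ρ = trans (eval-Free ρ s) (trans (ax e ρ) (symm (eval-Free ρ t)))

    eval-var-Free : ∀ t → Deriv (eval S (Free X) var t) t
    eval-var-Free t = trans (eval-Free var t) (sub-var t)

  module _ {X : Set} (R : Term S X → Term S X → Set) where

    Presented-InV : InV (Presented X R)
    Presented-InV = /-InV (Free X) (Cg-congruence (Free X) R) Free-InV

    eval-var : ∀ t → Cg S (Free X) R (eval S (Presented X R) var t) t
    eval-var t = cg-trans (eval-/ (Free X) (Cg-congruence (Free X) R) var t) (cg-incl (eval-var-Free t))

    holds-var⁺ : ∀ {s t} → Cg S (Free X) R s t → Holds S (Presented X R) var (s , t)
    holds-var⁺ {s} {t} d = cg-trans (eval-var s) (cg-trans d (cg-sym (eval-var t)))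

    presentation : Hom S (Free X) (Presented X R)
    presentation = record { fun = id ; fun-cong = cg-incl ; preserve = λ f ts → cg-incl refl }

    holds-var⁻ : ∀ {s t} → Holds S (Presented X R) var (s , t) → Cg S (Free X) R s t
    holds-var⁻ {s} {t} d = cg-trans (cg-sym (eval-var s)) (cg-trans d (eval-var t))

  Cg⇒⊨ : {X : Set} {Γ : List (Eqn S X)} {s t : Term S X} →
         Cg S (Free X) (ListRel S Γ) s t → Γ ⊨ ((s , t) ∷ [])
  Cg⇒⊨ d A A∈V ρ Γ-holds = Cg-sound A A∈V ρ (All.lookup Γ-holds) d ∷ []

  relations-hold : {X : Set} (Γ : List (Eqn S X)) → All (Holds S (Presented X (ListRel S Γ)) var) Γ
  relations-hold Γ = All.tabulate λ e∈Γ → holds-var⁺ (ListRel S Γ) (cg-base e∈Γ)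

  ⊨⇒All-Cg : {X : Set} {Γ Δ : List (Eqn S X)} → Γ ⊨ Δ →
             All (λ e → Cg S (Free X) (ListRel S Γ) (proj₁ e) (proj₂ e)) Δ
  ⊨⇒All-Cg {X} {Γ} Γ⊨Δ =
    All.map (holds-var⁻ (ListRel S Γ))
            (Γ⊨Δ (Presented X (ListRel S Γ)) (Presented-InV (ListRel S Γ)) var (relations-hold Γ))

  ⊨⇒Cg : {X : Set} {Γ : List (Eqn S X)} {s t : Term S X} →
         Γ ⊨ ((s , t) ∷ []) → Cg S (Free X) (ListRel S Γ) s t
  ⊨⇒Cg Γ⊨st with ⊨⇒All-Cg Γ⊨st
  ... | d ∷ [] = d

  ren-Deriv : {X Y : Set} (f : X → Y) {s t : Term S X} → Deriv s t → Deriv (ren S f s) (ren S f t)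
  ren-Deriv f (ax {s} {t} e σ) = trans (ren-sub σ s) (trans (ax e (ren S f ∘ σ)) (symm (ren-sub σ t)))
    where
    ren-sub : {X : Set} (σ : X → Term S _) → ∀ t → Deriv (ren S f (sub S σ t)) (sub S (ren S f ∘ σ) t)
    ren-sub σ (var x)    = refl
    ren-sub σ (app g ts) = cong g (λ i → ren-sub σ (ts i))
  ren-Deriv f refl         = refl
  ren-Deriv f (symm d)     = symm (ren-Deriv f d)
  ren-Deriv f (trans d d') = trans (ren-Deriv f d) (ren-Deriv f d')
  ren-Deriv f (cong g ds)  = cong g (λ i → ren-Deriv f (ds i))

  ren-hom : {X Y : Set} (f : X → Y) (R : Term S Y → Term S Y → Set) → Hom S (Free X) (Presented Y R)
  ren-hom f R = record { fun = ren S f ; fun-cong = cg-incl ∘ ren-Deriv f ; preserve = λ g ts → cg-incl refl }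

  Presented-map : {X Y : Set} (f : X → Y) {R : Term S X → Term S X → Set} {R' : Term S Y → Term S Y → Set} →
                  (∀ {s t} → R s t → Cg S (Free Y) R' (ren S f s) (ren S f t)) →
                  Hom S (Presented X R) (Presented Y R')
  Presented-map {X} {Y} f {R} {R'} R⊆R' = record
    { fun      = ren S f
    ; fun-cong = Cg-least-hom (Free X) (Presented Y R') (ren-hom f R') (≈-congruence (Presented Y R')) R⊆R'
    ; preserve = λ g ts → cg-incl refl
    }

  hom-on-Free : {X : Set} (M : Algebra S) (γ : Hom S (Free X) M) →
                ∀ t → _≈_ M (fun γ t) (eval S M (fun γ ∘ var) t)
  hom-on-Free M γ (var x)    = ≈.refl M
  hom-on-Free M γ (app f ts) = ≈.trans M (preserve γ f ts) (op-cong M f (λ i → hom-on-Free M γ (ts i)))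

  Presented-finitelyPresented : ∀ n (Γ : List (Eqn S (Fin n))) →
                                FinitelyPresented (Presented (Fin n) (ListRel S Γ))
  Presented-finitelyPresented n Γ =
    n , presentation (ListRel S Γ) , (λ t → t , cg-incl refl) , Γ , λ s t → id , id

  Free-finitelyPresented : ∀ n → FinitelyPresented (Free (Fin n))
  Free-finitelyPresented n =
    n , id-hom (Free (Fin n)) , (λ t → t , refl) ,
    [] , λ s t → cg-incl , Cg-least (Free _) (≈-congruence (Free _)) λ ()

  -- Fresh variables can be instantiated by the constant.
  fresh-variables-conservative : HasConstant S → {Y Z : Set} (Π : List (Eqn S Y)) {s t : Term S Y} →
    Cg S (Free (Y ⊎ Z)) (ListRel S (renEqs S inj₁ Π)) (ren S inj₁ s) (ren S inj₁ t) →
    Cg S (Free Y) (ListRel S Π) s t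
  fresh-variables-conservative c Π {s} {t} d = ⊨⇒Cg λ M M∈V ρ Π-holds →
    let ρ₊ = [ ρ , (λ _ → constant c M) ] in
    holds-ren⁻ M ρ₊ inj₁ (s , t) (All.head (Cg⇒⊨ d M M∈V ρ₊ (All-ren⁺ M ρ₊ inj₁ Π Π-holds))) ∷ []

  module Presentation {A : Algebra S} (P : FinitelyPresented A) where

    gens : ℕ
    gens = proj₁ P

    π : Hom S (Free (Fin gens)) A
    π = proj₁ (proj₂ P)

    relations : List (Eqn S (Fin gens))
    relations = proj₁ (proj₂ (proj₂ (proj₂ P)))

    private
      kernel-generated : ∀ s t → (_≈_ A (fun π s) (fun π t) → Cg S (Free _) (ListRel S relations) s t) ×
                                 (Cg S (Free _) (ListRel S relations) s t → _≈_ A (fun π s) (fun π t))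
      kernel-generated = proj₂ (proj₂ (proj₂ (proj₂ P)))

    pre : Carrier A → Term S (Fin gens)
    pre a = proj₁ (proj₁ (proj₂ (proj₂ P)) a)

    π-pre : ∀ a → _≈_ A (fun π (pre a)) a
    π-pre a = proj₂ (proj₁ (proj₂ (proj₂ P)) a)

    eval-pre : ∀ a → _≈_ A (eval S A (fun π ∘ var) (pre a)) a
    eval-pre a = ≈.trans A (≈.sym A (hom-on-Free A π (pre a))) (π-pre a)

    relations-hold-at-generators : All (Holds S A (fun π ∘ var)) relations
    relations-hold-at-generators = All.tabulate λ {(s , t)} st∈ →
      ≈.trans A (≈.sym A (hom-on-Free A π s))
        (≈.trans A (proj₂ (kernel-generated s t) (cg-base st∈)) (hom-on-Free A π t))

    induced-hom : (M : Algebra S) → InV M → (σ : Fin gens → Carrier M) →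
                  All (Holds S M σ) relations → Hom S A M
    induced-hom M M∈V σ relations-hold = record
      { fun      = eval S M σ ∘ pre
      ; fun-cong = λ {a} {a'} a≈a' → respects (≈.trans A (π-pre a) (≈.trans A a≈a' (≈.sym A (π-pre a'))))
      ; preserve = λ f as → respects
          (≈.trans A (π-pre (op A f as))
            (≈.trans A (op-cong A f (λ i → ≈.sym A (π-pre (as i)))) (≈.sym A (preserve π f (pre ∘ as)))))
      }
      where
      respects : ∀ {s t} → _≈_ A (fun π s) (fun π t) → _≈_ M (eval S M σ s) (eval S M σ t)
      respects {s} {t} = Cg-sound M M∈V σ (All.lookup relations-hold) ∘ proj₁ (kernel-generated s t)

module DeductiveAndMaehara (S : Signature) (E : Theory S) where
  open Variety S E
  open Evaluation S
  open Congruences S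
  open EquationalLogic S E

  maehara⇒deductive : RightUniformMaeharaInterpolation → RightUniformDeductiveInterpolation
  maehara⇒deductive MI n m Γ = Π , Γ⊨Π , uniform
    where
    Π = proj₁ (MI n m Γ)
    Γ,Σ⊨Δ⇔Π,Σ⊨Δ = proj₂ (MI n m Γ)

    Γ⊨Π : Γ ⊨ renEqs S inj₂ Π
    Γ⊨Π A A∈V ρ Γ-holds =
      All-ren⁺ A ρ inj₂ Π (All-ren⁻ A (ρ₀ ∘ yz↪) inj₁ Π (All-ren⁻ A ρ₀ yz↪ _ Π-holds))
      where
      ρ₀ : Ctx n m 0 → Carrier A
      ρ₀ = [ ρ , Vec.[] ]
      Π-holds : All (Holds S A ρ₀) (renEqs S yz↪ (renEqs S inj₁ Π))
      Π-holds = from (Γ,Σ⊨Δ⇔Π,Σ⊨Δ 0 [] (renEqs S inj₁ Π)) (λ B B∈V σ → All.++⁻ˡ _) A A∈V ρ₀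
                     (All.++⁺ (All-ren⁺ A ρ₀ inj₁ Γ Γ-holds) [])

    uniform : ∀ k (ε : Eqn S (Fin m ⊎ Fin k)) →
              renEqs S (inj₁ {B = Fin k}) Γ ⊨ (renEq S (yz↪ {n}) ε ∷ []) →
              renEqs S (inj₁ {B = Fin k}) Π ⊨ (ε ∷ [])
    uniform k ε Γ⊨ε A A∈V ρ Π-holds =
      to (Γ,Σ⊨Δ⇔Π,Σ⊨Δ k [] (ε ∷ [])) (λ B B∈V σ → Γ⊨ε B B∈V σ ∘ All.++⁻ˡ _) A A∈V ρ
         (All.++⁺ Π-holds [])

  module _ (DI : RightUniformDeductiveInterpolation) (CEP : CongruenceExtensionProperty)
           {n m k : ℕ} (Γ : List (Eqn S (Fin n ⊎ Fin m))) (Σ' : List (Eqn S (Fin m ⊎ Fin k))) where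

    private
      Π : List (Eqn S (Fin m))
      Π = proj₁ (DI n m Γ)

      Γ₁ : List (Eqn S (Ctx n m k))
      Γ₁ = renEqs S inj₁ Γ

      Π,Σ : List (Eqn S (Fin m ⊎ Fin k))
      Π,Σ = renEqs S inj₁ Π ++ Σ'

      G H : Algebra S
      G = Presented (Ctx n m k) (ListRel S Γ₁)
      H = Presented (Fin m ⊎ Fin k) (ListRel S Π,Σ)

      reflect : ∀ {a b} → _≈_ G (ren S yz↪ a) (ren S yz↪ b) → _≈_ H a b
      reflect {a} {b} d =
        Cg-least (Free _) (Cg-congruence (Free _) (ListRel S Π,Σ)) (cg-base ∘ ∈-++⁺ˡ)
          (⊨⇒Cg (proj₂ (proj₂ (DI n m Γ)) k (a , b) (Cg⇒⊨ d)))

      U : SubUniverse S G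
      U = record
        { pred   = λ t → Σ (Term S (Fin m ⊎ Fin k)) λ u → _≈_ G (ren S yz↪ u) t
        ; closed = λ f ts ps → app f (proj₁ ∘ ps) , cg-compat f (proj₂ ∘ ps)
        }

      θ : Congruence S (SubAlg S G U)
      θ = record
        { rel      = λ a b → _≈_ H (proj₁ (proj₂ a)) (proj₁ (proj₂ b))
        ; isEquivR = record { refl = ≈.refl H ; sym = ≈.sym H ; trans = ≈.trans H }
        ; ≈⊆rel    = λ {(_ , _ , a≈) (_ , _ , b≈)} e → reflect (cg-trans a≈ (cg-trans e (cg-sym b≈)))
        ; compat   = λ f → cg-compat f
        }

      Φ : Congruence S G
      Φ = proj₁ (CEP G (Presented-InV _) U θ)

      θ⇔Φ : ∀ a b → rel θ a b ⇔ rel Φ (proj₁ a) (proj₁ b)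
      θ⇔Φ = proj₂ (CEP G (Presented-InV _) U θ)

      inU : Term S (Fin m ⊎ Fin k) → Carrier (SubAlg S G U)
      inU u = ren S yz↪ u , u , cg-incl refl

      Γ,Σ⊆Φ : ∀ {s t} → Cg S (Free _) (ListRel S (Γ₁ ++ renEqs S yz↪ Σ')) s t → rel Φ s t
      Γ,Σ⊆Φ = Cg-least-hom (Free _) G (presentation _) Φ base
        where
        base : ∀ {s t} → ListRel S (Γ₁ ++ renEqs S yz↪ Σ') s t → rel Φ s t
        base e∈ with ∈-++⁻ Γ₁ e∈
        ... | inj₁ e∈Γ₁ = ≈⊆rel Φ (cg-base e∈Γ₁)
        ... | inj₂ e∈Σ with ∈-map⁻ (renEq S yz↪) e∈Σ
        ...   | (u , w) , uw∈Σ , ≡.refl = to (θ⇔Φ (inU u) (inU w)) (cg-base (∈-++⁺ʳ _ uw∈Σ))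

    interpolant-separates : ∀ Δ → (Γ₁ ++ renEqs S yz↪ Σ') ⊨ renEqs S yz↪ Δ → Π,Σ ⊨ Δ
    interpolant-separates Δ Γ,Σ⊨Δ A A∈V ρ hyps =
      All.map (Cg-sound A A∈V ρ (All.lookup hyps))
        (All.map (λ {(u , w)} d → from (θ⇔Φ (inU u) (inU w)) (Γ,Σ⊆Φ d))
                 (All.map⁻ (⊨⇒All-Cg Γ,Σ⊨Δ)))

  deductive∧cep⇒maehara : RightUniformDeductiveInterpolation → CongruenceExtensionProperty →
                          RightUniformMaeharaInterpolation
  deductive∧cep⇒maehara DI CEP n m Γ = Π , λ k Σ' Δ →
    mk⇔ (interpolant-separates DI CEP Γ Σ' Δ) (Π-side⇒Γ-side k Σ' Δ)
    where
    Π = proj₁ (DI n m Γ)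

    Π-side⇒Γ-side : ∀ k (Σ' Δ : List (Eqn S (Fin m ⊎ Fin k))) →
                    (renEqs S inj₁ Π ++ Σ') ⊨ Δ →
                    (renEqs S inj₁ Γ ++ renEqs S (yz↪ {n}) Σ') ⊨ renEqs S yz↪ Δ
    Π-side⇒Γ-side k Σ' Δ Π,Σ⊨Δ A A∈V ρ hyps =
      All-ren⁺ A ρ yz↪ Δ (Π,Σ⊨Δ A A∈V (ρ ∘ yz↪) (All.++⁺ Π-holds Σ-holds))
      where
      Γ-holds = All-ren⁻ A ρ inj₁ Γ (All.++⁻ˡ _ hyps)
      Σ-holds = All-ren⁻ A ρ yz↪ Σ' (All.++⁻ʳ _ hyps)
      Π-holds : All (Holds S A (ρ ∘ yz↪)) (renEqs S inj₁ Π)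
      Π-holds = All-ren⁺ A (ρ ∘ yz↪) inj₁ Π
                  (All-ren⁻ A (ρ ∘ inj₁) inj₂ Π (proj₁ (proj₂ (DI n m Γ)) A A∈V (ρ ∘ inj₁) Γ-holds))

  interpolant-entails : (DI : RightUniformDeductiveInterpolation) →
                        ∀ n m (Γ : List (Eqn S (Fin n ⊎ Fin m))) (ε : Eqn S (Fin m)) →
                        Γ ⊨ (renEq S inj₂ ε ∷ []) → proj₁ (DI n m Γ) ⊨ (ε ∷ [])
  interpolant-entails DI n m Γ ε Γ⊨ε A A∈V ρ Π-holds =
    holds-ren⁻ A ρ₀ inj₁ ε (All.head (proj₂ (proj₂ (DI n m Γ)) 0 (renEq S inj₁ ε) Γ₁⊨ε A A∈V ρ₀
                                       (All-ren⁺ A ρ₀ inj₁ _ Π-holds)))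
    ∷ []
    where
    ρ₀ : Fin m ⊎ Fin 0 → Carrier A
    ρ₀ = [ ρ , Vec.[] ]
    Γ₁⊨ε : renEqs S inj₁ Γ ⊨ (renEq S (yz↪ {n}) (renEq S inj₁ ε) ∷ [])
    Γ₁⊨ε B B∈V σ Γ₁-holds =
      holds-ren⁺ B σ yz↪ (renEq S inj₁ ε) (holds-ren⁺ B (σ ∘ yz↪) inj₁ ε
        (holds-ren⁻ B (σ ∘ inj₁) inj₂ ε (All.head (Γ⊨ε B B∈V (σ ∘ inj₁) (All-ren⁻ B σ inj₁ Γ Γ₁-holds)))))
      ∷ []

module MaeharaToCongruenceExtension (S : Signature) (E : Theory S) where
  open Variety S E
  open Evaluation S
  open Congruences S
  open EquationalLogic S E
  open DeductiveAndMaehara S E using (maehara⇒deductive)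

  module _ (MI : RightUniformMaeharaInterpolation) (A : Algebra S) (A∈V : InV A)
           (U : SubUniverse S A) (θ : Congruence S (SubAlg S A U)) where

    private
      SA Q : Algebra S
      SA = SubAlg S A U
      Q  = SA / θ

    record Context : Set where
      field
        nx ny   : ℕ
        vx      : Fin nx → Carrier A
        vy      : Fin ny → Carrier SA
        Γ       : List (Eqn S (Fin nx ⊎ Fin ny))
        Σ'      : List (Eqn S (Fin ny))
        Γ-holds : All (Holds S A [ vx , proj₁ ∘ vy ]) Γ
        Σ-holds : All (Holds S Q vy) Σ'

      Var : Set
      Var = Fin nx ⊎ Fin ny

      val : Var → Carrier A
      val = [ vx , proj₁ ∘ vy ]

      hyps : List (Eqn S Var)
      hyps = Γ ++ renEqs S inj₂ Σ'

    open Context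

    hyps-ren : (C : Context) {nx' ny' : ℕ} (fx : Fin (nx C) → Fin nx') (fy : Fin (ny C) → Fin ny')
               (M : Algebra S) (σ : Fin nx' ⊎ Fin ny' → Carrier M) →
               All (Holds S M σ) (renEqs S (Sum.map fx fy) (Γ C)) →
               All (Holds S M (σ ∘ inj₂)) (renEqs S fy (Σ' C)) →
               All (Holds S M (σ ∘ Sum.map fx fy)) (hyps C)
    hyps-ren C fx fy M σ Γ-ren Σ-ren =
      All.++⁺ (All-ren⁻ M σ _ (Γ C) Γ-ren)
              (All-ren⁺ M (σ ∘ Sum.map fx fy) inj₂ (Σ' C) (All-ren⁻ M (σ ∘ inj₂) fy (Σ' C) Σ-ren))

    record _≼_ (C D : Context) : Set₁ where
      field
        ren-x  : Fin (nx C) → Fin (nx D)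
        ren-y  : Fin (ny C) → Fin (ny D)
        val-≈  : ∀ v → _≈_ A (val D (Sum.map ren-x ren-y v)) (val C v)
        hyps-⊨ : ∀ M (σ : Var D → Carrier M) → All (Holds S M σ) (hyps D) →
                 All (Holds S M (σ ∘ Sum.map ren-x ren-y)) (hyps C)

      embed : Var C → Var D
      embed = Sum.map ren-x ren-y

    open _≼_

    ≼-trans : ∀ {C D F} → C ≼ D → D ≼ F → C ≼ F
    ≼-trans {C} C≼D D≼F = record
      { ren-x  = ren-x D≼F ∘ ren-x C≼D
      ; ren-y  = ren-y D≼F ∘ ren-y C≼D
      ; val-≈  = λ where
          (inj₁ i) → ≈.trans A (val-≈ D≼F (inj₁ (ren-x C≼D i))) (val-≈ C≼D (inj₁ i))
          (inj₂ i) → ≈.trans A (val-≈ D≼F (inj₂ (ren-y C≼D i))) (val-≈ C≼D (inj₂ i))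
      ; hyps-⊨ = λ M σ → All-holds-cong M (λ { (inj₁ _) → ≈.refl M ; (inj₂ _) → ≈.refl M }) (hyps C)
                          ∘ hyps-⊨ C≼D M (σ ∘ embed D≼F) ∘ hyps-⊨ D≼F M σ
      }

    ∅ : Context
    ∅ = record { nx = 0 ; ny = 0 ; vx = Vec.[] ; vy = Vec.[] ; Γ = [] ; Σ' = [] ; Γ-holds = [] ; Σ-holds = [] }

    assume : (C : Context) (e : Eqn S (Var C)) → Holds S A (val C) e → Context
    assume C e e-holds = record C { Γ = e ∷ Γ C ; Γ-holds = e-holds ∷ Γ-holds C }

    module Merge (C₁ C₂ : Context) where
      private
        e₁ : Var C₁ → Fin (nx C₁ + nx C₂) ⊎ Fin (ny C₁ + ny C₂)
        e₁ = Sum.map (_↑ˡ nx C₂) (_↑ˡ ny C₂)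
        e₂ : Var C₂ → Fin (nx C₁ + nx C₂) ⊎ Fin (ny C₁ + ny C₂)
        e₂ = Sum.map (nx C₁ ↑ʳ_) (ny C₁ ↑ʳ_)

        vx' : Fin (nx C₁ + nx C₂) → Carrier A
        vx' = vx C₁ Vec.++ vx C₂
        vy' : Fin (ny C₁ + ny C₂) → Carrier SA
        vy' = vy C₁ Vec.++ vy C₂
        val' : Fin (nx C₁ + nx C₂) ⊎ Fin (ny C₁ + ny C₂) → Carrier A
        val' = [ vx' , proj₁ ∘ vy' ]

        val-e₁ : ∀ v → val' (e₁ v) ≡ val C₁ v
        val-e₁ (inj₁ i) = lookup-++ˡ (vx C₁) (vx C₂) i
        val-e₁ (inj₂ i) = ≡.cong proj₁ (lookup-++ˡ (vy C₁) (vy C₂) i)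
        val-e₂ : ∀ v → val' (e₂ v) ≡ val C₂ v
        val-e₂ (inj₁ i) = lookup-++ʳ (vx C₁) (vx C₂) i
        val-e₂ (inj₂ i) = ≡.cong proj₁ (lookup-++ʳ (vy C₁) (vy C₂) i)

        Γ₁' = renEqs S e₁ (Γ C₁)
        Σ₁' = renEqs S (_↑ˡ ny C₂) (Σ' C₁)

      merged : Context
      merged = record
        { nx = nx C₁ + nx C₂ ; ny = ny C₁ + ny C₂ ; vx = vx' ; vy = vy'
        ; Γ  = Γ₁' ++ renEqs S e₂ (Γ C₂)
        ; Σ' = Σ₁' ++ renEqs S (ny C₁ ↑ʳ_) (Σ' C₂)
        ; Γ-holds = All.++⁺
            (All-ren⁺ A val' e₁ (Γ C₁) (All-holds-cong A (≡⇒≈ A ∘ ≡.sym ∘ val-e₁) (Γ C₁) (Γ-holds C₁)))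
            (All-ren⁺ A val' e₂ (Γ C₂) (All-holds-cong A (≡⇒≈ A ∘ ≡.sym ∘ val-e₂) (Γ C₂) (Γ-holds C₂)))
        ; Σ-holds = All.++⁺
            (All-ren⁺ Q vy' _ (Σ' C₁)
              (All-holds-cong Q (≈⊆rel θ ∘ ≡⇒≈ SA ∘ ≡.sym ∘ lookup-++ˡ (vy C₁) (vy C₂)) (Σ' C₁) (Σ-holds C₁)))
            (All-ren⁺ Q vy' _ (Σ' C₂)
              (All-holds-cong Q (≈⊆rel θ ∘ ≡⇒≈ SA ∘ ≡.sym ∘ lookup-++ʳ (vy C₁) (vy C₂)) (Σ' C₂) (Σ-holds C₂)))
        }

      private
        Σ-split : ∀ M (σ : Var merged → Carrier M) → All (Holds S M σ) (hyps merged) →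
                  All (Holds S M (σ ∘ inj₂)) (Σ' merged)
        Σ-split M σ = All-ren⁻ M σ inj₂ (Σ' merged) ∘ All.++⁻ʳ (Γ merged)

      ≼-mergedˡ : C₁ ≼ merged
      ≼-mergedˡ = record
        { ren-x = _ ; ren-y = _ ; val-≈ = ≡⇒≈ A ∘ val-e₁
        ; hyps-⊨ = λ M σ h → hyps-ren C₁ _ _ M σ (All.++⁻ˡ Γ₁' (All.++⁻ˡ (Γ merged) h))
                                 (All.++⁻ˡ Σ₁' (Σ-split M σ h))
        }

      ≼-mergedʳ : C₂ ≼ merged
      ≼-mergedʳ = record
        { ren-x = _ ; ren-y = _ ; val-≈ = ≡⇒≈ A ∘ val-e₂
        ; hyps-⊨ = λ M σ h → hyps-ren C₂ _ _ M σ (All.++⁻ʳ Γ₁' (All.++⁻ˡ (Γ merged) h))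
                                 (All.++⁻ʳ Σ₁' (Σ-split M σ h))
        }

    merge : (C₁ C₂ : Context) → Σ[ D ∈ Context ] (C₁ ≼ D × C₂ ≼ D)
    merge C₁ C₂ = merged , ≼-mergedˡ , ≼-mergedʳ
      where open Merge C₁ C₂

    merge-all : ∀ k (Cs : Fin k → Context) → Σ[ D ∈ Context ] (∀ i → Cs i ≼ D)
    merge-all = finite-upper-bound _≼_ ≼-trans ∅ merge

    record Witness (a b : Carrier A) : Set₁ where
      field
        ctx      : Context
        lhs rhs  : Term S (Var ctx)
        lhs-val  : _≈_ A (eval S A (val ctx) lhs) a
        rhs-val  : _≈_ A (eval S A (val ctx) rhs) b
        entails  : hyps ctx ⊨ ((lhs , rhs) ∷ [])

    open Witness

    transport : ∀ {a b} (w : Witness a b) {D : Context} → ctx w ≼ D → Witness a b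
    transport w {D} C≼D = record
      { ctx     = D
      ; lhs     = ren S (embed C≼D) (lhs w)
      ; rhs     = ren S (embed C≼D) (rhs w)
      ; lhs-val = ≈.trans A (eval-ren A (val D) _ (lhs w)) (≈.trans A (eval-cong A (val-≈ C≼D) (lhs w)) (lhs-val w))
      ; rhs-val = ≈.trans A (eval-ren A (val D) _ (rhs w)) (≈.trans A (eval-cong A (val-≈ C≼D) (rhs w)) (rhs-val w))
      ; entails = λ M M∈V σ h →
          holds-ren⁺ M σ _ (lhs w , rhs w) (All.head (entails w M M∈V (σ ∘ embed C≼D) (hyps-⊨ C≼D M σ h))) ∷ []
      }

    θ-on-A : Carrier A → Carrier A → Set
    θ-on-A a b = Σ (pred U a) λ a∈U → Σ (pred U b) λ b∈U → rel θ (a , a∈U) (b , b∈U)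

    pair-context : Carrier SA → Carrier SA → Context
    pair-context a b = record { nx = 0 ; ny = 2 ; vx = Vec.[] ; vy = a Vec.∷ b Vec.∷ Vec.[]
                              ; Γ = [] ; Σ' = [] ; Γ-holds = [] ; Σ-holds = [] }

    θ-witness : ∀ {a b} → θ-on-A a b → Witness a b
    θ-witness {a} {b} (a∈U , b∈U , aθb) = record
      { ctx = record (pair-context (a , a∈U) (b , b∈U)) { Σ' = (var zero , var (suc zero)) ∷ [] ; Σ-holds = aθb ∷ [] }
      ; lhs = var (inj₂ zero) ; rhs = var (inj₂ (suc zero))
      ; lhs-val = ≈.refl A ; rhs-val = ≈.refl A
      ; entails = λ M M∈V σ → id
      }

    ≈-witness : ∀ {a b} → _≈_ A a b → Witness a b
    ≈-witness {a} a≈b = record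
      { ctx = record { nx = 1 ; ny = 0 ; vx = λ _ → a ; vy = Vec.[] ; Γ = [] ; Σ' = [] ; Γ-holds = [] ; Σ-holds = [] }
      ; lhs = var (inj₁ zero) ; rhs = var (inj₁ zero)
      ; lhs-val = ≈.refl A ; rhs-val = a≈b
      ; entails = λ M M∈V σ _ → ≈.refl M ∷ []
      }

    sym-witness : ∀ {a b} → Witness a b → Witness b a
    sym-witness w = record
      { ctx = ctx w ; lhs = rhs w ; rhs = lhs w ; lhs-val = rhs-val w ; rhs-val = lhs-val w
      ; entails = λ M M∈V σ h → ≈.sym M (All.head (entails w M M∈V σ h)) ∷ []
      }

    trans-witness : ∀ {a b c} → Witness a b → Witness b c → Witness a c
    trans-witness w₁ w₂ with merge (ctx w₁) (ctx w₂)
    ... | D , ≼D , ≼D' = record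
      { ctx = assume D (rhs w , lhs w') (≈.trans A (rhs-val w) (≈.sym A (lhs-val w')))
      ; lhs = lhs w ; rhs = rhs w' ; lhs-val = lhs-val w ; rhs-val = rhs-val w'
      ; entails = λ where
          M M∈V σ (w≈w' ∷ h) → ≈.trans M (All.head (entails w M M∈V σ h))
                                 (≈.trans M w≈w' (All.head (entails w' M M∈V σ h))) ∷ []
      }
      where
      w  = transport w₁ ≼D
      w' = transport w₂ ≼D'

    compat-witness : ∀ f {as bs : Fin (arity S f) → Carrier A} → (∀ i → Witness (as i) (bs i)) →
                     Witness (op A f as) (op A f bs)
    compat-witness f ws with merge-all _ (ctx ∘ ws)
    ... | D , ≼D = record
      { ctx = D
      ; lhs = app f (lhs ∘ ws') ; rhs = app f (rhs ∘ ws')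
      ; lhs-val = op-cong A f (lhs-val ∘ ws') ; rhs-val = op-cong A f (rhs-val ∘ ws')
      ; entails = λ M M∈V σ h → op-cong M f (λ i → All.head (entails (ws' i) M M∈V σ h)) ∷ []
      }
      where
      ws' = λ i → transport (ws i) (≼D i)

    witness : ∀ {a b} → Cg S A θ-on-A a b → Witness a b
    witness (cg-base aθb)    = θ-witness aθb
    witness (cg-incl a≈b)    = ≈-witness a≈b
    witness (cg-sym d)       = sym-witness (witness d)
    witness (cg-trans d d')  = trans-witness (witness d) (witness d')
    witness (cg-compat f ds) = compat-witness f (witness ∘ ds)

    entailed-in-θ : (C : Context) (i j : Fin (ny C)) →
                    hyps C ⊨ ((var (inj₂ i) , var (inj₂ j)) ∷ []) → rel θ (vy C i) (vy C j)
    entailed-in-θ C i j hyps⊨ij =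
      All.head (to (Γ,Σ⊨Δ⇔Π,Σ⊨Δ 0 Σ₀ Δ₀) Γ,Σ⊨Δ Q (/-InV SA θ (SubAlg-InV A U A∈V)) ρ
                   (All.++⁺ Π-holds-in-Q (All-ren⁺ Q ρ inj₁ (Σ' C) (Σ-holds C))))
      where
      Π = proj₁ (MI (nx C) (ny C) (Γ C))
      Γ,Σ⊨Δ⇔Π,Σ⊨Δ = proj₂ (MI (nx C) (ny C) (Γ C))

      Σ₀ Δ₀ : List (Eqn S (Fin (ny C) ⊎ Fin 0))
      Σ₀ = renEqs S inj₁ (Σ' C)
      Δ₀ = (var (inj₁ i) , var (inj₁ j)) ∷ []

      Γ,Σ⊨Δ : (renEqs S inj₁ (Γ C) ++ renEqs S (yz↪ {nx C}) Σ₀) ⊨ renEqs S yz↪ Δ₀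
      Γ,Σ⊨Δ M M∈V σ h = All.head (hyps⊨ij M M∈V (σ ∘ inj₁)
        (All.++⁺ (All-ren⁻ M σ inj₁ (Γ C) (All.++⁻ˡ _ h))
                 (All-ren⁺ M (σ ∘ inj₁) inj₂ (Σ' C)
                    (All-ren⁻ M (σ ∘ yz↪) inj₁ (Σ' C) (All-ren⁻ M σ yz↪ Σ₀ (All.++⁻ʳ _ h)))))) ∷ []

      ρ : Fin (ny C) ⊎ Fin 0 → Carrier SA
      ρ = [ vy C , Vec.[] ]

      Π-holds-in-Q : All (Holds S Q ρ) (renEqs S inj₁ Π)
      Π-holds-in-Q = All-ren⁺ Q ρ inj₁ Π
        (All.map (λ {e} → holds-/⁺ SA θ (vy C) e ∘ holds-SubAlg A U (vy C) e)
          (All-ren⁻ A (val C) inj₂ Π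
            (proj₁ (proj₂ (maehara⇒deductive MI (nx C) (ny C) (Γ C))) A A∈V (val C) (Γ-holds C))))

    Cg-θ-on-A⊆θ : ∀ a b → Cg S A θ-on-A (proj₁ a) (proj₁ b) → rel θ a b
    Cg-θ-on-A⊆θ a b d with merge (ctx (witness d)) (pair-context a b)
    ... | D , ≼D , ab≼D =
      Con.trans θ (Con.sym θ (≈⊆rel θ (val-≈ ab≼D (inj₂ zero))))
        (Con.trans θ (entailed-in-θ C ya yb ya=yb) (≈⊆rel θ (val-≈ ab≼D (inj₂ (suc zero)))))
      where
      w = transport (witness d) ≼D
      ya = ren-y ab≼D zero
      yb = ren-y ab≼D (suc zero)
      D' = assume D (var (inj₂ ya) , lhs w) (≈.trans A (val-≈ ab≼D (inj₂ zero)) (≈.sym A (lhs-val w)))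
      C  = assume D' (var (inj₂ yb) , rhs w) (≈.trans A (val-≈ ab≼D (inj₂ (suc zero))) (≈.sym A (rhs-val w)))
      ya=yb : hyps C ⊨ ((var (inj₂ ya) , var (inj₂ yb)) ∷ [])
      ya=yb M M∈V σ (yb=rhs ∷ ya=lhs ∷ h) =
        ≈.trans M ya=lhs (≈.trans M (All.head (entails w M M∈V σ h)) (≈.sym M yb=rhs)) ∷ []

  maehara⇒cep : RightUniformMaeharaInterpolation → CongruenceExtensionProperty
  maehara⇒cep MI A A∈V U θ =
    Cg-congruence A (θ-on-A MI A A∈V U θ) ,
    λ a b → mk⇔ (λ aθb → cg-base (proj₂ a , proj₂ b , aθb)) (Cg-θ-on-A⊆θ MI A A∈V U θ a b)

module MaeharaToAmalgamation (S : Signature) (E : Theory S) where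
  open Variety S E
  open Evaluation S
  open Congruences S
  open EquationalLogic S E
  open DeductiveAndMaehara S E using (maehara⇒deductive)

  -- The interpolant over ȳ of the K-side hypotheses holds in A, hence on the L side.
  maehara-separation :
    RightUniformMaeharaInterpolation → {A K L : Algebra S} → InV K → InV L →
    (eK : Emb S A K) (eL : Emb S A L) →
    ∀ {nk na nl} (vK : Fin nk → Carrier K) (vA : Fin na → Carrier A) (vL : Fin nl → Carrier L)
    (ΓK : List (Eqn S (Fin nk ⊎ Fin na))) (ΓL : List (Eqn S (Fin na ⊎ Fin nl))) →
    All (Holds S K [ vK , fun (hom eK) ∘ vA ]) ΓK → All (Holds S L [ fun (hom eL) ∘ vA , vL ]) ΓL →
    (δ : Eqn S (Fin na ⊎ Fin nl)) →
    (renEqs S (inj₁ {B = Fin nl}) ΓK ++ renEqs S (yz↪ {nk}) ΓL) ⊨ renEqs S yz↪ (δ ∷ []) →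
    Holds S L [ fun (hom eL) ∘ vA , vL ] δ
  maehara-separation MI {A} {K} {L} K∈V L∈V eK eL vK vA vL ΓK ΓL ΓK-holds ΓL-holds δ ΓK,ΓL⊨δ =
    All.head (to (proj₂ (MI _ _ ΓK) _ ΓL (δ ∷ [])) ΓK,ΓL⊨δ L L∈V _ (All.++⁺ Π-holds-in-L ΓL-holds))
    where
    Π = proj₁ (MI _ _ ΓK)

    Π-holds-in-K : All (Holds S K (fun (hom eK) ∘ vA)) Π
    Π-holds-in-K = All-ren⁻ K _ inj₂ Π (proj₁ (proj₂ (maehara⇒deductive MI _ _ ΓK)) K K∈V _ ΓK-holds)

    Π-holds-in-L : All (Holds S L [ fun (hom eL) ∘ vA , vL ]) (renEqs S inj₁ Π)
    Π-holds-in-L = All-ren⁺ L _ inj₁ Π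
      (All.map (λ {e} → holds-hom A L (hom eL) vA e ∘ holds-emb⁻ A K eK vA e) Π-holds-in-K)

  -- Renames r p t says that ren r p is t; stated structurally since Term has function-valued arguments.
  data Renames {W X : Set} (r : W → X) : Term S W → Term S X → Set where
    var≡ : ∀ {w x} → r w ≡ x → Renames r (var w) (var x)
    app≡ : ∀ f {ps ts} → (∀ i → Renames r (ps i) (ts i)) → Renames r (app f ps) (app f ts)

  Renames-ren : ∀ {W W' X : Set} {r : W → X} {r' : W' → X} (e : W → W') → (∀ w → r' (e w) ≡ r w) →
                ∀ {p t} → Renames r p t → Renames r' (ren S e p) t
  Renames-ren e r'e≡r (var≡ rw≡x)  = var≡ (≡.trans (r'e≡r _) rw≡x)
  Renames-ren e r'e≡r (app≡ f rps) = app≡ f (λ i → Renames-ren e r'e≡r (rps i))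

  ⨆ : ∀ {k} → (Fin k → ℕ) → ℕ
  ⨆ {zero}  b = 0
  ⨆ {suc k} b = b zero ⊔ ⨆ (b ∘ suc)

  ≤-⨆ : ∀ {k} (b : Fin k → ℕ) i → b i ≤ ⨆ b
  ≤-⨆ b zero    = m≤m⊔n _ _
  ≤-⨆ b (suc i) = ≤-trans (≤-⨆ (b ∘ suc) i) (m≤n⊔m _ _)

  bound : Term S ℕ → ℕ
  bound (var n)    = suc n
  bound (app f ts) = ⨆ (bound ∘ ts)

  Renames-sub : ∀ {W X : Set} {r : W → X} (N : ℕ) (σ' : ℕ → Term S W) (σ : ℕ → Term S X) →
                (∀ n → n < N → Renames r (σ' n) (σ n)) →
                ∀ t → bound t ≤ N → Renames r (sub S σ' t) (sub S σ t)
  Renames-sub N σ' σ σ'~σ (var n)    n<N = σ'~σ n n<N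
  Renames-sub N σ' σ σ'~σ (app f ts) ≤N  =
    app≡ f (λ i → Renames-sub N σ' σ σ'~σ (ts i) (≤-trans (≤-⨆ (bound ∘ ts) i) ≤N))

  module Amalgam (MI : RightUniformMaeharaInterpolation) {A B C : Algebra S} (B∈V : InV B) (C∈V : InV C)
                 (i : Emb S A B) (j : Emb S A C) where

    X : Set
    X = Carrier B ⊎ Carrier C

    data Glue : Term S X → Term S X → Set where
      B-op : ∀ f (bs : Fin (arity S f) → Carrier B) → Glue (app f (var ∘ inj₁ ∘ bs)) (var (inj₁ (op B f bs)))
      B-≈  : ∀ {b b'} → _≈_ B b b' → Glue (var (inj₁ b)) (var (inj₁ b'))
      C-op : ∀ f (cs : Fin (arity S f) → Carrier C) → Glue (app f (var ∘ inj₂ ∘ cs)) (var (inj₂ (op C f cs)))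
      C-≈  : ∀ {c c'} → _≈_ C c c' → Glue (var (inj₂ c)) (var (inj₂ c'))
      glue : ∀ a → Glue (var (inj₁ (fun (hom i) a))) (var (inj₂ (fun (hom j) a)))

    D : Algebra S
    D = Presented X Glue

    record Context : Set where
      field
        nB nA nC : ℕ
        vB       : Fin nB → Carrier B
        vA       : Fin nA → Carrier A
        vC       : Fin nC → Carrier C
        ΓB       : List (Eqn S (Fin nB ⊎ Fin nA))
        ΓC       : List (Eqn S (Fin nA ⊎ Fin nC))
        ΓB-holds : All (Holds S B [ vB , fun (hom i) ∘ vA ]) ΓB
        ΓC-holds : All (Holds S C [ fun (hom j) ∘ vA , vC ]) ΓC

      Var : Set
      Var = Ctx nB nA nC

      valB : Fin nB ⊎ Fin nA → Carrier B
      valB = [ vB , fun (hom i) ∘ vA ]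

      real : Var → X
      real = [ inj₁ ∘ valB , inj₂ ∘ vC ]

      joint : List (Eqn S (Fin nB ⊎ Fin nA)) → List (Eqn S (Fin nA ⊎ Fin nC)) → List (Eqn S Var)
      joint eb ec = renEqs S inj₁ eb ++ renEqs S (yz↪ {nB}) ec

      hyps : List (Eqn S Var)
      hyps = joint ΓB ΓC

    open Context

    record _≼_ (K L : Context) : Set₁ where
      field
        ren-B  : Fin (nB K) → Fin (nB L)
        ren-A  : Fin (nA K) → Fin (nA L)
        ren-C  : Fin (nC K) → Fin (nC L)
        vB-≡   : ∀ k → vB L (ren-B k) ≡ vB K k
        vA-≡   : ∀ k → vA L (ren-A k) ≡ vA K k
        vC-≡   : ∀ k → vC L (ren-C k) ≡ vC K k
        hyps-⊨ : ∀ M (σ : Var L → Carrier M) → All (Holds S M σ) (hyps L) →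
                 All (Holds S M (σ ∘ Sum.map (Sum.map ren-B ren-A) ren-C)) (hyps K)

      embed : Var K → Var L
      embed = Sum.map (Sum.map ren-B ren-A) ren-C

      real-embed : ∀ w → real L (embed w) ≡ real K w
      real-embed (inj₁ (inj₁ k)) = ≡.cong inj₁ (vB-≡ k)
      real-embed (inj₁ (inj₂ k)) = ≡.cong (inj₁ ∘ fun (hom i)) (vA-≡ k)
      real-embed (inj₂ k)        = ≡.cong inj₂ (vC-≡ k)

    open _≼_

    ≼-trans : ∀ {K L M} → K ≼ L → L ≼ M → K ≼ M
    ≼-trans {K} K≼L L≼M = record
      { ren-B = ren-B L≼M ∘ ren-B K≼L ; ren-A = ren-A L≼M ∘ ren-A K≼L ; ren-C = ren-C L≼M ∘ ren-C K≼L
      ; vB-≡ = λ k → ≡.trans (vB-≡ L≼M (ren-B K≼L k)) (vB-≡ K≼L k)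
      ; vA-≡ = λ k → ≡.trans (vA-≡ L≼M (ren-A K≼L k)) (vA-≡ K≼L k)
      ; vC-≡ = λ k → ≡.trans (vC-≡ L≼M (ren-C K≼L k)) (vC-≡ K≼L k)
      ; hyps-⊨ = λ N σ → All-holds-cong N (λ { (inj₁ (inj₁ _)) → ≈.refl N ; (inj₁ (inj₂ _)) → ≈.refl N
                                             ; (inj₂ _) → ≈.refl N }) (hyps K)
                          ∘ hyps-⊨ K≼L N (σ ∘ embed L≼M) ∘ hyps-⊨ L≼M N σ
      }

    ∅ : Context
    ∅ = record { nB = 0 ; nA = 0 ; nC = 0 ; vB = Vec.[] ; vA = Vec.[] ; vC = Vec.[]
               ; ΓB = [] ; ΓC = [] ; ΓB-holds = [] ; ΓC-holds = [] }

    assume : (K : Context) (eb : List (Eqn S (Fin (nB K) ⊎ Fin (nA K)))) (ec : List (Eqn S (Fin (nA K) ⊎ Fin (nC K)))) →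
             All (Holds S B [ vB K , fun (hom i) ∘ vA K ]) eb → All (Holds S C [ fun (hom j) ∘ vA K , vC K ]) ec →
             Context
    assume K eb ec eb-holds ec-holds = record K
      { ΓB = eb ++ ΓB K ; ΓC = ec ++ ΓC K
      ; ΓB-holds = All.++⁺ eb-holds (ΓB-holds K) ; ΓC-holds = All.++⁺ ec-holds (ΓC-holds K) }

    assume-split : (K : Context) (eb : List (Eqn S (Fin (nB K) ⊎ Fin (nA K)))) (ec : List (Eqn S (Fin (nA K) ⊎ Fin (nC K))))
                   (M : Algebra S) (σ : Var K → Carrier M) → All (Holds S M σ) (joint K (eb ++ ΓB K) (ec ++ ΓC K)) →
                   All (Holds S M σ) (joint K eb ec) × All (Holds S M σ) (hyps K)
    assume-split K eb ec M σ h =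
      All.++⁺ (All-ren⁺ M σ inj₁ eb (All.++⁻ˡ eb ΓB')) (All-ren⁺ M σ yz↪ ec (All.++⁻ˡ ec ΓC')) ,
      All.++⁺ (All-ren⁺ M σ inj₁ (ΓB K) (All.++⁻ʳ eb ΓB')) (All-ren⁺ M σ yz↪ (ΓC K) (All.++⁻ʳ ec ΓC'))
      where
      ΓB' = All-ren⁻ M σ inj₁ (eb ++ ΓB K) (All.++⁻ˡ _ h)
      ΓC' = All-ren⁻ M σ yz↪ (ec ++ ΓC K) (All.++⁻ʳ _ h)

    hyps-ren : (K : Context) {b a c : ℕ} (fB : Fin (nB K) → Fin b) (fA : Fin (nA K) → Fin a) (fC : Fin (nC K) → Fin c)
               (M : Algebra S) (σ : Ctx b a c → Carrier M) →
               All (Holds S M (σ ∘ inj₁)) (renEqs S (Sum.map fB fA) (ΓB K)) →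
               All (Holds S M (σ ∘ yz↪)) (renEqs S (Sum.map fA fC) (ΓC K)) →
               All (Holds S M (σ ∘ Sum.map (Sum.map fB fA) fC)) (hyps K)
    hyps-ren K fB fA fC M σ ΓB-ren ΓC-ren = All.++⁺
      (All-ren⁺ M _ inj₁ (ΓB K) (All-ren⁻ M (σ ∘ inj₁) _ (ΓB K) ΓB-ren))
      (All-ren⁺ M _ yz↪ (ΓC K) (All-holds-cong M (λ { (inj₁ _) → ≈.refl M ; (inj₂ _) → ≈.refl M }) (ΓC K)
                                  (All-ren⁻ M (σ ∘ yz↪) _ (ΓC K) ΓC-ren)))

    module Merge (K₁ K₂ : Context) where
      private
        vB' : Fin (nB K₁ + nB K₂) → Carrier B
        vB' = vB K₁ Vec.++ vB K₂
        vA' : Fin (nA K₁ + nA K₂) → Carrier A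
        vA' = vA K₁ Vec.++ vA K₂
        vC' : Fin (nC K₁ + nC K₂) → Carrier C
        vC' = vC K₁ Vec.++ vC K₂

        eB₁ : Fin (nB K₁) ⊎ Fin (nA K₁) → Fin (nB K₁ + nB K₂) ⊎ Fin (nA K₁ + nA K₂)
        eB₁ = Sum.map (_↑ˡ nB K₂) (_↑ˡ nA K₂)
        eB₂ : Fin (nB K₂) ⊎ Fin (nA K₂) → Fin (nB K₁ + nB K₂) ⊎ Fin (nA K₁ + nA K₂)
        eB₂ = Sum.map (nB K₁ ↑ʳ_) (nA K₁ ↑ʳ_)
        eC₁ : Fin (nA K₁) ⊎ Fin (nC K₁) → Fin (nA K₁ + nA K₂) ⊎ Fin (nC K₁ + nC K₂)
        eC₁ = Sum.map (_↑ˡ nA K₂) (_↑ˡ nC K₂)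
        eC₂ : Fin (nA K₂) ⊎ Fin (nC K₂) → Fin (nA K₁ + nA K₂) ⊎ Fin (nC K₁ + nC K₂)
        eC₂ = Sum.map (nA K₁ ↑ʳ_) (nC K₁ ↑ʳ_)

        valB-e₁ : ∀ x → [ vB' , fun (hom i) ∘ vA' ]′ (eB₁ x) ≡ [ vB K₁ , fun (hom i) ∘ vA K₁ ]′ x
        valB-e₁ (inj₁ k) = lookup-++ˡ (vB K₁) (vB K₂) k
        valB-e₁ (inj₂ k) = ≡.cong (fun (hom i)) (lookup-++ˡ (vA K₁) (vA K₂) k)
        valB-e₂ : ∀ x → [ vB' , fun (hom i) ∘ vA' ]′ (eB₂ x) ≡ [ vB K₂ , fun (hom i) ∘ vA K₂ ]′ x
        valB-e₂ (inj₁ k) = lookup-++ʳ (vB K₁) (vB K₂) k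
        valB-e₂ (inj₂ k) = ≡.cong (fun (hom i)) (lookup-++ʳ (vA K₁) (vA K₂) k)
        valC-e₁ : ∀ x → [ fun (hom j) ∘ vA' , vC' ]′ (eC₁ x) ≡ [ fun (hom j) ∘ vA K₁ , vC K₁ ]′ x
        valC-e₁ (inj₁ k) = ≡.cong (fun (hom j)) (lookup-++ˡ (vA K₁) (vA K₂) k)
        valC-e₁ (inj₂ k) = lookup-++ˡ (vC K₁) (vC K₂) k
        valC-e₂ : ∀ x → [ fun (hom j) ∘ vA' , vC' ]′ (eC₂ x) ≡ [ fun (hom j) ∘ vA K₂ , vC K₂ ]′ x
        valC-e₂ (inj₁ k) = ≡.cong (fun (hom j)) (lookup-++ʳ (vA K₁) (vA K₂) k)
        valC-e₂ (inj₂ k) = lookup-++ʳ (vC K₁) (vC K₂) k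

        ΓB₁ = renEqs S eB₁ (ΓB K₁)
        ΓC₁ = renEqs S eC₁ (ΓC K₁)

      merged : Context
      merged = record
        { nB = nB K₁ + nB K₂ ; nA = nA K₁ + nA K₂ ; nC = nC K₁ + nC K₂ ; vB = vB' ; vA = vA' ; vC = vC'
        ; ΓB = ΓB₁ ++ renEqs S eB₂ (ΓB K₂)
        ; ΓC = ΓC₁ ++ renEqs S eC₂ (ΓC K₂)
        ; ΓB-holds = All.++⁺
            (All-ren⁺ B _ eB₁ (ΓB K₁) (All-holds-cong B (≡⇒≈ B ∘ ≡.sym ∘ valB-e₁) (ΓB K₁) (ΓB-holds K₁)))
            (All-ren⁺ B _ eB₂ (ΓB K₂) (All-holds-cong B (≡⇒≈ B ∘ ≡.sym ∘ valB-e₂) (ΓB K₂) (ΓB-holds K₂)))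
        ; ΓC-holds = All.++⁺
            (All-ren⁺ C _ eC₁ (ΓC K₁) (All-holds-cong C (≡⇒≈ C ∘ ≡.sym ∘ valC-e₁) (ΓC K₁) (ΓC-holds K₁)))
            (All-ren⁺ C _ eC₂ (ΓC K₂) (All-holds-cong C (≡⇒≈ C ∘ ≡.sym ∘ valC-e₂) (ΓC K₂) (ΓC-holds K₂)))
        }

      private
        ΓB-part : ∀ M (σ : Var merged → Carrier M) → All (Holds S M σ) (hyps merged) →
                  All (Holds S M (σ ∘ inj₁)) (ΓB merged)
        ΓB-part M σ = All-ren⁻ M σ inj₁ (ΓB merged) ∘ All.++⁻ˡ _
        ΓC-part : ∀ M (σ : Var merged → Carrier M) → All (Holds S M σ) (hyps merged) →
                  All (Holds S M (σ ∘ yz↪)) (ΓC merged)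
        ΓC-part M σ = All-ren⁻ M σ yz↪ (ΓC merged) ∘ All.++⁻ʳ (renEqs S inj₁ (ΓB merged))

      ≼-mergedˡ : K₁ ≼ merged
      ≼-mergedˡ = record
        { ren-B = _ ; ren-A = _ ; ren-C = _
        ; vB-≡ = lookup-++ˡ (vB K₁) (vB K₂) ; vA-≡ = lookup-++ˡ (vA K₁) (vA K₂)
        ; vC-≡ = lookup-++ˡ (vC K₁) (vC K₂)
        ; hyps-⊨ = λ M σ h → hyps-ren K₁ _ _ _ M σ (All.++⁻ˡ ΓB₁ (ΓB-part M σ h))
                                                  (All.++⁻ˡ ΓC₁ (ΓC-part M σ h))
        }

      ≼-mergedʳ : K₂ ≼ merged
      ≼-mergedʳ = record
        { ren-B = _ ; ren-A = _ ; ren-C = _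
        ; vB-≡ = lookup-++ʳ (vB K₁) (vB K₂) ; vA-≡ = lookup-++ʳ (vA K₁) (vA K₂)
        ; vC-≡ = lookup-++ʳ (vC K₁) (vC K₂)
        ; hyps-⊨ = λ M σ h → hyps-ren K₂ _ _ _ M σ (All.++⁻ʳ ΓB₁ (ΓB-part M σ h))
                                                  (All.++⁻ʳ ΓC₁ (ΓC-part M σ h))
        }

    merge : (K₁ K₂ : Context) → Σ[ L ∈ Context ] (K₁ ≼ L × K₂ ≼ L)
    merge K₁ K₂ = merged , ≼-mergedˡ , ≼-mergedʳ
      where open Merge K₁ K₂

    merge-all : ∀ k (Ks : Fin k → Context) → Σ[ L ∈ Context ] (∀ i → Ks i ≼ L)
    merge-all = finite-upper-bound _≼_ ≼-trans ∅ merge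

    record Witness (s t : Term S X) : Set₁ where
      field
        ctx       : Context
        lhs rhs   : Term S (Var ctx)
        lhs-names : Renames (real ctx) lhs s
        rhs-names : Renames (real ctx) rhs t
        entails   : hyps ctx ⊨ ((lhs , rhs) ∷ [])

    open Witness

    transport : ∀ {s t} (w : Witness s t) {L : Context} → ctx w ≼ L → Witness s t
    transport w {L} K≼L = record
      { ctx       = L
      ; lhs       = ren S (embed K≼L) (lhs w)
      ; rhs       = ren S (embed K≼L) (rhs w)
      ; lhs-names = Renames-ren (embed K≼L) (real-embed K≼L) (lhs-names w)
      ; rhs-names = Renames-ren (embed K≼L) (real-embed K≼L) (rhs-names w)
      ; entails   = λ M M∈V σ h →
          holds-ren⁺ M σ _ (lhs w , rhs w) (All.head (entails w M M∈V (σ ∘ embed K≼L) (hyps-⊨ K≼L M σ h))) ∷ []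
      }

    record Pattern (t : Term S X) : Set₁ where
      field
        context : Context
        term    : Term S (Var context)
        names   : Renames (real context) term t

    pattern-of : ∀ t → Pattern t
    pattern-of (var (inj₁ b)) = record
      { context = record ∅ { nB = 1 ; vB = λ _ → b ; ΓB = [] ; ΓB-holds = [] }
      ; term = var (inj₁ (inj₁ zero)) ; names = var≡ ≡.refl }
    pattern-of (var (inj₂ c)) = record
      { context = record ∅ { nC = 1 ; vC = λ _ → c ; ΓC = [] ; ΓC-holds = [] }
      ; term = var (inj₂ zero) ; names = var≡ ≡.refl }
    pattern-of (app f ts) with merge-all _ (Pattern.context ∘ pattern-of ∘ ts)
    ... | L , ≼L = record
      { context = L
      ; term = app f (λ k → ren S (embed (≼L k)) (Pattern.term (pattern-of (ts k))))
      ; names = app≡ f (λ k → Renames-ren (embed (≼L k)) (real-embed (≼L k)) (Pattern.names (pattern-of (ts k))))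
      }

    record Coincidence (K : Context) (p q : Term S (Var K)) : Set₁ where
      field
        eb       : List (Eqn S (Fin (nB K) ⊎ Fin (nA K)))
        ec       : List (Eqn S (Fin (nA K) ⊎ Fin (nC K)))
        eb-holds : All (Holds S B [ vB K , fun (hom i) ∘ vA K ]) eb
        ec-holds : All (Holds S C [ fun (hom j) ∘ vA K , vC K ]) ec
        entails  : joint K eb ec ⊨ ((p , q) ∷ [])

    coincide : (K : Context) → ∀ {t p q} → Renames (real K) p t → Renames (real K) q t → Coincidence K p q
    coincide K (var≡ {inj₁ u} ≡t) (var≡ {inj₁ u'} ≡t') = record
      { eb = (var u , var u') ∷ [] ; ec = []
      ; eb-holds = ≡⇒≈ B (inj₁-injective (≡.trans ≡t (≡.sym ≡t'))) ∷ [] ; ec-holds = []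
      ; entails = λ M M∈V σ → id }
    coincide K (var≡ {inj₂ u} ≡t) (var≡ {inj₂ u'} ≡t') = record
      { eb = [] ; ec = (var (inj₂ u) , var (inj₂ u')) ∷ []
      ; eb-holds = [] ; ec-holds = ≡⇒≈ C (inj₂-injective (≡.trans ≡t (≡.sym ≡t'))) ∷ []
      ; entails = λ M M∈V σ → id }
    coincide K (var≡ {inj₁ _} ≡.refl) (var≡ {inj₂ _} ())
    coincide K (var≡ {inj₂ _} ≡.refl) (var≡ {inj₁ _} ())
    coincide K (app≡ f ps~ts) (app≡ .f qs~ts) = record
      { eb = concat (tabulate (eb ∘ cs)) ; ec = concat (tabulate (ec ∘ cs))
      ; eb-holds = All.concat⁺ (All.tabulate⁺ (eb-holds ∘ cs))
      ; ec-holds = All.concat⁺ (All.tabulate⁺ (ec-holds ∘ cs))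
      ; entails = λ M M∈V σ h → op-cong M f (λ k → All.head (entails (cs k) M M∈V σ (restrict M σ h k))) ∷ []
      }
      where
      open Coincidence
      cs = λ k → coincide K (ps~ts k) (qs~ts k)
      restrict : ∀ M (σ : Var K → Carrier M) →
                 All (Holds S M σ) (joint K (concat (tabulate (eb ∘ cs))) (concat (tabulate (ec ∘ cs)))) →
                 ∀ k → All (Holds S M σ) (joint K (eb (cs k)) (ec (cs k)))
      restrict M σ h k = All.++⁺
        (All-ren⁺ M σ inj₁ _ (All.tabulate⁻ (All.concat⁻ (All-ren⁻ M σ inj₁ _ (All.++⁻ˡ _ h))) k))
        (All-ren⁺ M σ yz↪ _ (All.tabulate⁻ (All.concat⁻ (All-ren⁻ M σ yz↪ _ (All.++⁻ʳ _ h))) k))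

    refl-witness : ∀ t → Witness t t
    refl-witness t = record
      { ctx = context ; lhs = term ; rhs = term ; lhs-names = names ; rhs-names = names
      ; entails = λ M M∈V σ _ → ≈.refl M ∷ [] }
      where open Pattern (pattern-of t)

    sym-witness : ∀ {s t} → Witness s t → Witness t s
    sym-witness w = record
      { ctx = ctx w ; lhs = rhs w ; rhs = lhs w ; lhs-names = rhs-names w ; rhs-names = lhs-names w
      ; entails = λ M M∈V σ h → ≈.sym M (All.head (entails w M M∈V σ h)) ∷ [] }

    trans-witness : ∀ {s t u} → Witness s t → Witness t u → Witness s u
    trans-witness w₁ w₂ with merge (ctx w₁) (ctx w₂)
    ... | L , ≼L , ≼L' = record
      { ctx = assume L eb ec eb-holds ec-holds
      ; lhs = lhs w ; rhs = rhs w' ; lhs-names = lhs-names w ; rhs-names = rhs-names w'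
      ; entails = λ M M∈V σ h → let (h-middle , h-L) = assume-split L eb ec M σ h in
          ≈.trans M (All.head (entails w M M∈V σ h-L))
            (≈.trans M (All.head (Coincidence.entails middle M M∈V σ h-middle)) (All.head (entails w' M M∈V σ h-L)))
          ∷ []
      }
      where
      w  = transport w₁ ≼L
      w' = transport w₂ ≼L'
      middle = coincide L (rhs-names w) (lhs-names w')
      open Coincidence middle using (eb ; ec ; eb-holds ; ec-holds)

    compat-witness : ∀ f {ss ts : Fin (arity S f) → Term S X} → (∀ k → Witness (ss k) (ts k)) →
                     Witness (app f ss) (app f ts)
    compat-witness f ws with merge-all _ (ctx ∘ ws)
    ... | L , ≼L = record
      { ctx = L ; lhs = app f (lhs ∘ ws') ; rhs = app f (rhs ∘ ws')
      ; lhs-names = app≡ f (lhs-names ∘ ws') ; rhs-names = app≡ f (rhs-names ∘ ws')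
      ; entails = λ M M∈V σ h → op-cong M f (λ k → All.head (entails (ws' k) M M∈V σ h)) ∷ [] }
      where
      ws' = λ k → transport (ws k) (≼L k)

    -- σ is replaced by σ' on a context holding patterns of σ 0, …, σ (N - 1), which covers all
    -- variables of s and t; the remaining variables are sent to the pattern of σ 0.
    axiom-witness : ∀ {s t} → E s t → (σ : ℕ → Term S X) → Witness (sub S σ s) (sub S σ t)
    axiom-witness {s} {t} s=t σ = on (merge-all N (Pattern.context ∘ pattern-of ∘ σ ∘ toℕ))
      where
      N = suc (bound s ⊔ bound t)

      on : Σ[ L ∈ Context ] (∀ k → Pattern.context (pattern-of (σ (toℕ k))) ≼ L) → Witness (sub S σ s) (sub S σ t)
      on (L , ≼L) = record
        { ctx = L ; lhs = sub S σ' s ; rhs = sub S σ' t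
        ; lhs-names = Renames-sub N σ' σ σ'~σ s (≤-trans (m≤m⊔n _ _) (n≤1+n _))
        ; rhs-names = Renames-sub N σ' σ σ'~σ t (≤-trans (m≤n⊔m _ _) (n≤1+n _))
        ; entails = λ M M∈V ρ _ → deriv-sound M M∈V ρ (ax s=t σ') ∷ [] }
        where
        σ-pattern : ∀ k → Term S (Var L)
        σ-pattern k = ren S (embed (≼L k)) (Pattern.term (pattern-of (σ (toℕ k))))
        σ-pattern~σ : ∀ k → Renames (real L) (σ-pattern k) (σ (toℕ k))
        σ-pattern~σ k = Renames-ren (embed (≼L k)) (real-embed (≼L k)) (Pattern.names (pattern-of (σ (toℕ k))))
        σ' : ℕ → Term S (Var L)
        σ' n with n <? N
        ... | yes n<N = σ-pattern (fromℕ< n<N)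
        ... | no  _   = σ-pattern zero
        σ'~σ : ∀ n → n < N → Renames (real L) (σ' n) (σ n)
        σ'~σ n n<N with n <? N
        ... | yes n<N' =
          ≡.subst (Renames (real L) (σ-pattern (fromℕ< n<N')) ∘ σ) (toℕ-fromℕ< n<N') (σ-pattern~σ (fromℕ< n<N'))
        ... | no  n≮N  = ⊥-elim (n≮N n<N)

    glue-witness : ∀ {s t} → Glue s t → Witness s t
    glue-witness (B-op f bs) = record
      { ctx = record ∅ { nB = suc (arity S f) ; vB = op B f bs Vec.∷ bs
                       ; ΓB = (app f (var ∘ inj₁ ∘ suc) , var (inj₁ zero)) ∷ [] ; ΓB-holds = ≈.refl B ∷ [] }
      ; lhs = app f (var ∘ inj₁ ∘ inj₁ ∘ suc) ; rhs = var (inj₁ (inj₁ zero))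
      ; lhs-names = app≡ f (λ _ → var≡ ≡.refl) ; rhs-names = var≡ ≡.refl
      ; entails = λ M M∈V σ h → All.head h ∷ [] }
    glue-witness (B-≈ {b} {b'} b≈b') = record
      { ctx = record ∅ { nB = 2 ; vB = b Vec.∷ b' Vec.∷ Vec.[]
                       ; ΓB = (var (inj₁ zero) , var (inj₁ (suc zero))) ∷ [] ; ΓB-holds = b≈b' ∷ [] }
      ; lhs = var (inj₁ (inj₁ zero)) ; rhs = var (inj₁ (inj₁ (suc zero)))
      ; lhs-names = var≡ ≡.refl ; rhs-names = var≡ ≡.refl
      ; entails = λ M M∈V σ h → All.head h ∷ [] }
    glue-witness (C-op f cs) = record
      { ctx = record ∅ { nC = suc (arity S f) ; vC = op C f cs Vec.∷ cs
                       ; ΓC = (app f (var ∘ inj₂ ∘ suc) , var (inj₂ zero)) ∷ [] ; ΓC-holds = ≈.refl C ∷ [] }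
      ; lhs = app f (var ∘ inj₂ ∘ suc) ; rhs = var (inj₂ zero)
      ; lhs-names = app≡ f (λ _ → var≡ ≡.refl) ; rhs-names = var≡ ≡.refl
      ; entails = λ M M∈V σ h → All.head h ∷ [] }
    glue-witness (C-≈ {c} {c'} c≈c') = record
      { ctx = record ∅ { nC = 2 ; vC = c Vec.∷ c' Vec.∷ Vec.[]
                       ; ΓC = (var (inj₂ zero) , var (inj₂ (suc zero))) ∷ [] ; ΓC-holds = c≈c' ∷ [] }
      ; lhs = var (inj₂ zero) ; rhs = var (inj₂ (suc zero))
      ; lhs-names = var≡ ≡.refl ; rhs-names = var≡ ≡.refl
      ; entails = λ M M∈V σ h → All.head h ∷ [] }
    glue-witness (glue a) = record
      { ctx = record ∅ { nA = 1 ; nC = 1 ; vA = λ _ → a ; vC = λ _ → fun (hom j) a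
                       ; ΓB = [] ; ΓC = (var (inj₁ zero) , var (inj₂ zero)) ∷ []
                       ; ΓB-holds = [] ; ΓC-holds = ≈.refl C ∷ [] }
      ; lhs = var (inj₁ (inj₂ zero)) ; rhs = var (inj₂ zero)
      ; lhs-names = var≡ ≡.refl ; rhs-names = var≡ ≡.refl
      ; entails = λ M M∈V σ h → All.head h ∷ [] }

    Deriv-witness : ∀ {s t} → Deriv s t → Witness s t
    Deriv-witness (ax s=t σ)   = axiom-witness s=t σ
    Deriv-witness (refl {t})   = refl-witness t
    Deriv-witness (symm d)     = sym-witness (Deriv-witness d)
    Deriv-witness (trans d d') = trans-witness (Deriv-witness d) (Deriv-witness d')
    Deriv-witness (cong f ds)  = compat-witness f (Deriv-witness ∘ ds)

    witness : ∀ {s t} → _≈_ D s t → Witness s t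
    witness (cg-base g)       = glue-witness g
    witness (cg-incl d)       = Deriv-witness d
    witness (cg-sym d)        = sym-witness (witness d)
    witness (cg-trans d d')   = trans-witness (witness d) (witness d')
    witness (cg-compat f ds)  = compat-witness f (witness ∘ ds)

    C-separation : (K : Context) (k k' : Fin (nC K)) →
                   hyps K ⊨ ((var (inj₂ k) , var (inj₂ k')) ∷ []) → _≈_ C (vC K k) (vC K k')
    C-separation K k k' =
      maehara-separation MI B∈V C∈V i j (vB K) (vA K) (vC K) (ΓB K) (ΓC K) (ΓB-holds K) (ΓC-holds K)
                         (var (inj₂ k) , var (inj₂ k'))

    -- B-separation is C-separation with B and C exchanged, which reverses the order of the variable blocks.
    module Swapped (K : Context) where
      ΓC' : List (Eqn S (Fin (nC K) ⊎ Fin (nA K)))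
      ΓC' = renEqs S swap (ΓC K)

      ΓB' : List (Eqn S (Fin (nA K) ⊎ Fin (nB K)))
      ΓB' = renEqs S swap (ΓB K)

      ΓC'-holds : All (Holds S C [ vC K , fun (hom j) ∘ vA K ]) ΓC'
      ΓC'-holds = All-ren⁺ C _ swap (ΓC K)
        (All-holds-cong C (λ { (inj₁ _) → ≈.refl C ; (inj₂ _) → ≈.refl C }) (ΓC K) (ΓC-holds K))

      ΓB'-holds : All (Holds S B [ fun (hom i) ∘ vA K , vB K ]) ΓB'
      ΓB'-holds = All-ren⁺ B _ swap (ΓB K)
        (All-holds-cong B (λ { (inj₁ _) → ≈.refl B ; (inj₂ _) → ≈.refl B }) (ΓB K) (ΓB-holds K))

      valB-swap : ∀ v → [ fun (hom i) ∘ vA K , vB K ] (swap v) ≡ valB K v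
      valB-swap (inj₁ _) = ≡.refl
      valB-swap (inj₂ _) = ≡.refl

      τ : Var K → Ctx (nC K) (nA K) (nB K)
      τ (inj₁ (inj₁ b)) = inj₂ b
      τ (inj₁ (inj₂ a)) = inj₁ (inj₂ a)
      τ (inj₂ c)        = inj₁ (inj₁ c)

      τ-swap : ∀ v → yz↪ {nC K} (swap v) ≡ τ (inj₁ v)
      τ-swap (inj₁ _) = ≡.refl
      τ-swap (inj₂ _) = ≡.refl

      hyps-at-τ : ∀ M (σ : Ctx (nC K) (nA K) (nB K) → Carrier M) →
                  All (Holds S M σ) (renEqs S inj₁ ΓC' ++ renEqs S (yz↪ {nC K}) ΓB') → All (Holds S M (σ ∘ τ)) (hyps K)
      hyps-at-τ M σ h = All.++⁺
        (All-ren⁺ M (σ ∘ τ) inj₁ (ΓB K)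
          (All-holds-cong M (λ { (inj₁ _) → ≈.refl M ; (inj₂ _) → ≈.refl M }) (ΓB K)
            (All-ren⁻ M (σ ∘ yz↪) swap (ΓB K) (All-ren⁻ M σ yz↪ ΓB' (All.++⁻ʳ _ h)))))
        (All-ren⁺ M (σ ∘ τ) yz↪ (ΓC K)
          (All-holds-cong M (λ { (inj₁ _) → ≈.refl M ; (inj₂ _) → ≈.refl M }) (ΓC K)
            (All-ren⁻ M (σ ∘ inj₁) swap (ΓC K) (All-ren⁻ M σ inj₁ ΓC' (All.++⁻ˡ _ h)))))

    B-separation : (K : Context) (u u' : Fin (nB K) ⊎ Fin (nA K)) →
                   hyps K ⊨ ((var (inj₁ u) , var (inj₁ u')) ∷ []) → _≈_ B (valB K u) (valB K u')
    B-separation K u u' K⊨u=u' =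
      ≈.trans B (≡⇒≈ B (≡.sym (valB-swap u)))
        (≈.trans B (maehara-separation MI C∈V B∈V j i (vC K) (vA K) (vB K) ΓC' ΓB' ΓC'-holds ΓB'-holds
                      (var (swap u) , var (swap u')) swapped-entails)
                   (≡⇒≈ B (valB-swap u')))
      where
      open Swapped K
      swapped-entails : (renEqs S inj₁ ΓC' ++ renEqs S (yz↪ {nC K}) ΓB') ⊨
                        renEqs S yz↪ ((var (swap u) , var (swap u')) ∷ [])
      swapped-entails M M∈V σ h =
        ≈.trans M (≡⇒≈ M (≡.cong σ (τ-swap u)))
          (≈.trans M (All.head (K⊨u=u' M M∈V (σ ∘ τ) (hyps-at-τ M σ h)))
                     (≡⇒≈ M (≡.cong σ (≡.sym (τ-swap u')))))
        ∷ []

    C-reflects : ∀ {c c'} → Witness (var (inj₂ c)) (var (inj₂ c')) → _≈_ C c c'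
    C-reflects w = reflect (ctx w) (lhs-names w) (rhs-names w) (entails w)
      where
      reflect : (K : Context) {c c' : Carrier C} {p q : Term S (Var K)} →
                Renames (real K) p (var (inj₂ c)) → Renames (real K) q (var (inj₂ c')) →
                hyps K ⊨ ((p , q) ∷ []) → _≈_ C c c'
      reflect K (var≡ {inj₂ k} ≡c) (var≡ {inj₂ k'} ≡c') K⊨ =
        ≈.trans C (≡⇒≈ C (≡.sym (inj₂-injective ≡c)))
          (≈.trans C (C-separation K k k' K⊨) (≡⇒≈ C (inj₂-injective ≡c')))
      reflect K (var≡ {inj₁ _} ()) _ _
      reflect K (var≡ {inj₂ _} _) (var≡ {inj₁ _} ()) _

    B-reflects : ∀ {b b'} → Witness (var (inj₁ b)) (var (inj₁ b')) → _≈_ B b b'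
    B-reflects w = reflect (ctx w) (lhs-names w) (rhs-names w) (entails w)
      where
      reflect : (K : Context) {b b' : Carrier B} {p q : Term S (Var K)} →
                Renames (real K) p (var (inj₁ b)) → Renames (real K) q (var (inj₁ b')) →
                hyps K ⊨ ((p , q) ∷ []) → _≈_ B b b'
      reflect K (var≡ {inj₁ u} ≡b) (var≡ {inj₁ u'} ≡b') K⊨ =
        ≈.trans B (≡⇒≈ B (≡.sym (inj₁-injective ≡b)))
          (≈.trans B (B-separation K u u' K⊨) (≡⇒≈ B (inj₁-injective ≡b')))
      reflect K (var≡ {inj₂ _} ()) _ _
      reflect K (var≡ {inj₁ _} _) (var≡ {inj₂ _} ()) _

    B↪D : Emb S B D
    B↪D = record
      { hom = record { fun = var ∘ inj₁ ; fun-cong = cg-base ∘ B-≈ ; preserve = λ f bs → cg-sym (cg-base (B-op f bs)) }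
      ; injective = B-reflects ∘ witness }

    C↪D : Emb S C D
    C↪D = record
      { hom = record { fun = var ∘ inj₂ ; fun-cong = cg-base ∘ C-≈ ; preserve = λ f cs → cg-sym (cg-base (C-op f cs)) }
      ; injective = C-reflects ∘ witness }

  maehara⇒amalgamation : RightUniformMaeharaInterpolation → AmalgamationProperty
  maehara⇒amalgamation MI A B C _ B∈V C∈V i j =
    D , Presented-InV Glue , B↪D , C↪D , cg-base ∘ glue
    where open Amalgam MI B∈V C∈V i j

module CompactLiftings (S : Signature) (E : Theory S) where
  open Variety S E
  open Evaluation S
  open Congruences S
  open EquationalLogic S E
  open DeductiveAndMaehara S E using (interpolant-entails)

  module RightAdjoint (DI : RightUniformDeductiveInterpolation) {A B : Algebra S} (B∈V : InV B)
                      (FA : FinitelyPresented A) (FB : FinitelyPresented B) (h : Hom S A B) where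
    private
      module PA = Presentation FA
      module PB = Presentation FB

      X Y : Set
      X = Fin PB.gens
      Y = Fin PA.gens

      link : Y → Eqn S (X ⊎ Y)
      link y = ren S inj₁ (PB.pre (fun h (fun PA.π (var y)))) , var (inj₂ y)

      pre-pair : Carrier B × Carrier B → Eqn S (X ⊎ Y)
      pre-pair (b , b') = ren S inj₁ (PB.pre b) , ren S inj₁ (PB.pre b')

      π-pair : Eqn S Y → Carrier A × Carrier A
      π-pair (s , t) = fun PA.π s , fun PA.π t

      Γ : KCon S B → List (Eqn S (X ⊎ Y))
      Γ φ = renEqs S inj₁ PB.relations ++ (tabulate link ++ map pre-pair (generators φ))

      Π : KCon S B → List (Eqn S Y)
      Π φ = proj₁ (DI _ _ (Γ φ))

    g : KCon S B → KCon S A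
    g φ = compactCongruence A (map π-pair (Π φ))

    private
      image-entailed : ∀ φ a a' → Cg S B (ListRel S (generators φ)) (fun h a) (fun h a') →
                       Γ φ ⊨ (renEq S inj₂ (PA.pre a , PA.pre a') ∷ [])
      image-entailed φ a a' ha~ha' M M∈V ρ hyps =
        holds-ren⁺ M ρ inj₂ (PA.pre a , PA.pre a')
          (≈.trans M (A-side a) (≈.trans M β-respects-φ (≈.sym M (A-side a'))))
        ∷ []
        where
        links-and-φ = All.++⁻ʳ (renEqs S inj₁ PB.relations) hyps

        β : Hom S B M
        β = PB.induced-hom M M∈V (ρ ∘ inj₁) (All-ren⁻ M ρ inj₁ PB.relations (All.++⁻ˡ _ hyps))

        βhπ-on-generators : ∀ y → _≈_ M (fun β (fun h (fun PA.π (var y)))) (ρ (inj₂ y))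
        βhπ-on-generators y =
          ≈.trans M (≈.sym M (eval-ren M ρ inj₁ (PB.pre _))) (All.tabulate⁻ (All.++⁻ˡ _ links-and-φ) y)

        A-side : ∀ a → _≈_ M (eval S M (ρ ∘ inj₂) (PA.pre a)) (fun β (fun h a))
        A-side a = begin
          eval S M (ρ ∘ inj₂) (PA.pre a)                        ≈⟨ eval-cong M βhπ-on-generators (PA.pre a) ⟨
          eval S M (fun (β ∘ₕ (h ∘ₕ PA.π)) ∘ var) (PA.pre a)    ≈⟨ hom-on-Free M (β ∘ₕ (h ∘ₕ PA.π)) (PA.pre a) ⟨
          fun β (fun h (fun PA.π (PA.pre a)))                   ≈⟨ fun-cong β (fun-cong h (PA.π-pre a)) ⟩
          fun β (fun h a)                                       ∎
          where open import Relation.Binary.Reasoning.Setoid (setoid M)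

        β-respects-φ : _≈_ M (fun β (fun h a)) (fun β (fun h a'))
        β-respects-φ = Cg-least-hom B M β (≈-congruence M)
          (λ {b} {b'} bb'∈ → holds-ren⁻ M ρ inj₁ (PB.pre b , PB.pre b')
                                (All.lookup (All.map⁻ (All.++⁻ʳ _ links-and-φ)) bb'∈))
          ha~ha'

      module InQuotient (φ : KCon S B) where
        θ = proj₁ φ
        ρ : X ⊎ Y → Carrier B
        ρ = [ fun PB.π ∘ var , fun h ∘ fun PA.π ∘ var ]

        eval-pre : ∀ b → _≈_ B (eval S B ρ (ren S inj₁ (PB.pre b))) b
        eval-pre b = ≈.trans B (eval-ren B ρ inj₁ (PB.pre b)) (PB.eval-pre b)

        Γ-holds : All (Holds S (B / θ) ρ) (Γ φ)
        Γ-holds = All.++⁺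
          (All-ren⁺ (B / θ) ρ inj₁ PB.relations
             (All.map (λ {e} → holds-/⁺ B θ _ e) PB.relations-hold-at-generators))
          (All.++⁺ (All.tabulate⁺ λ y → holds-/⁺ B θ ρ (link y) (eval-pre _))
                   (All.map⁺ (All.tabulate λ {(b , b')} bb'∈ →
                      holds-/ B θ ρ (ren S inj₁ (PB.pre b)) (ren S inj₁ (PB.pre b')) (Con.trans θ (≈⊆rel θ (eval-pre b))
                        (Con.trans θ (generator∈compact φ bb'∈)
                          (≈⊆rel θ (≈.sym B (eval-pre b'))))))))

        Π-in-φ : ∀ {s t} → (s , t) ∈ Π φ → rel θ (fun h (fun PA.π s)) (fun h (fun PA.π t))
        Π-in-φ {s} {t} st∈ = Con.trans θ (≈⊆rel θ (hom-on-Free B (h ∘ₕ PA.π) s))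
          (Con.trans θ (Con.sym θ (eval-/ B θ _ s))
            (Con.trans θ (All.lookup (All-ren⁻ (B / θ) ρ inj₂ (Π φ)
                                  (proj₁ (proj₂ (DI _ _ (Γ φ))) (B / θ) (/-InV B θ B∈V) ρ Γ-holds)) st∈)
              (Con.trans θ (eval-/ B θ _ t) (≈⊆rel θ (≈.sym B (hom-on-Free B (h ∘ₕ PA.π) t))))))

    adjunction : ∀ ψ φ → _⊆_ S (liftRel S h ψ) (rel (proj₁ φ)) ⇔ _⊆_ S (rel (proj₁ ψ)) (rel (proj₁ (g φ)))
    adjunction ψ φ = mk⇔ lift⊆φ⇒ψ⊆gφ ψ⊆gφ⇒lift⊆φ
      where
      lift⊆φ⇒ψ⊆gφ : _⊆_ S (liftRel S h ψ) (rel (proj₁ φ)) → _⊆_ S (rel (proj₁ ψ)) (rel (proj₁ (g φ)))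
      lift⊆φ⇒ψ⊆gφ lift⊆φ = Cg-least A (proj₁ (g φ)) generator-in-gφ ∘ compact⇒Cg ψ
        where
        generator-in-gφ : ∀ {a a'} → (a , a') ∈ generators ψ → rel (proj₁ (g φ)) a a'
        generator-in-gφ {a} {a'} aa'∈ =
          cg-trans (cg-sym (cg-incl (PA.π-pre a)))
            (cg-trans (Cg-least-hom (Free Y) A PA.π (proj₁ (g φ)) (cg-base ∘ ∈-map⁺ π-pair)
                         (⊨⇒Cg (interpolant-entails DI _ _ (Γ φ) _ (image-entailed φ a a' ha~ha'))))
                      (cg-incl (PA.π-pre a')))
          where
          ha~ha' = compact⇒Cg φ (lift⊆φ (cg-base (a , a' , generator∈compact ψ aa'∈ , ≡.refl , ≡.refl)))

      ψ⊆gφ⇒lift⊆φ : _⊆_ S (rel (proj₁ ψ)) (rel (proj₁ (g φ))) → _⊆_ S (liftRel S h ψ) (rel (proj₁ φ))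
      ψ⊆gφ⇒lift⊆φ ψ⊆gφ = Cg-least B (proj₁ φ) image-in-φ
        where
        π-pair-in-φ : ∀ {a a'} → (a , a') ∈ map π-pair (Π φ) → rel (proj₁ φ) (fun h a) (fun h a')
        π-pair-in-φ aa'∈ with ∈-map⁻ π-pair aa'∈
        ... | _ , st∈ , ≡.refl = InQuotient.Π-in-φ φ st∈

        image-in-φ : ∀ {b b'} → ImageRel S h (rel (proj₁ ψ)) b b' → rel (proj₁ φ) b b'
        image-in-φ (a , a' , aψa' , ≡.refl , ≡.refl) = Cg-least-hom A B h (proj₁ φ) π-pair-in-φ (ψ⊆gφ aψa')

  deductive⇒adjoints : RightUniformDeductiveInterpolation → CompactLiftingsHaveRightAdjoints
  deductive⇒adjoints DI A B _ B∈V FA FB h = g , adjunction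
    where open RightAdjoint DI B∈V FA FB h

module AmalgamationToInterpolation (S : Signature) (E : Theory S) where
  open Variety S E
  open Evaluation S
  open Congruences S
  open EquationalLogic S E

  module UniformInterpolant (c : HasConstant S) (AP : AmalgamationProperty)
                            (ADJ : CompactLiftingsHaveRightAdjoints)
                            {n m : ℕ} (Γ : List (Eqn S (Fin n ⊎ Fin m))) where
    private
      x̄ȳ : Fin n ⊎ Fin m → Fin (n + m)
      x̄ȳ = join n m

      Γ' : List (Eqn S (Fin (n + m)))
      Γ' = renEqs S x̄ȳ Γ

      B : Algebra S
      B = Presented (Fin (n + m)) (ListRel S Γ')

      incl : Hom S (Free (Fin m)) B
      incl = ren-hom (x̄ȳ ∘ inj₂) (ListRel S Γ')

      adjoint : LiftingHasRightAdjoint S incl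
      adjoint = ADJ (Free (Fin m)) B Free-InV (Presented-InV _)
                    (Free-finitelyPresented m) (Presented-finitelyPresented (n + m) Γ') incl

      θ₀ : KCon S (Free (Fin m))
      θ₀ = proj₁ adjoint (≈-compact B)

    Π : List (Eqn S (Fin m))
    Π = generators θ₀

    private
      Π-in-B : ∀ {s t} → (s , t) ∈ Π → _≈_ B (ren S (x̄ȳ ∘ inj₂) s) (ren S (x̄ȳ ∘ inj₂) t)
      Π-in-B {s} {t} st∈ = from (proj₂ adjoint θ₀ (≈-compact B)) id
                             (cg-base (s , t , generator∈compact θ₀ st∈ , ≡.refl , ≡.refl))

      B-reflects-Π : ∀ {s t} → _≈_ B (ren S (x̄ȳ ∘ inj₂) s) (ren S (x̄ȳ ∘ inj₂) t) →
                     Cg S (Free (Fin m)) (ListRel S Π) s t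
      B-reflects-Π {s} {t} incl-s≈t = compact⇒Cg θ₀
        (to (proj₂ adjoint (compactCongruence _ ((s , t) ∷ [])) (≈-compact B)) lift⊆≈ (cg-base (here ≡.refl)))
        where
        lift⊆≈ : _⊆_ S (liftRel S incl (compactCongruence _ ((s , t) ∷ []))) (_≈_ B)
        lift⊆≈ = Cg-least B (≈-congruence B) λ where
          (_ , _ , d , ≡.refl , ≡.refl) → Cg-least-hom (Free _) B incl (≈-congruence B)
                                             (λ { (here ≡.refl) → incl-s≈t }) d

    Γ⊨Π : Γ ⊨ renEqs S inj₂ Π
    Γ⊨Π A A∈V ρ Γ-holds = All-ren⁺ A ρ inj₂ Π (All.tabulate Π-holds)
      where
      ρ' : Fin (n + m) → Carrier A
      ρ' = ρ ∘ splitAt n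
      ρ≈ρ'x̄ȳ : ∀ x → _≈_ A (ρ x) (ρ' (x̄ȳ x))
      ρ≈ρ'x̄ȳ x = ≡⇒≈ A (≡.cong ρ (≡.sym (splitAt-join n m x)))
      Π-holds : ∀ {e} → e ∈ Π → Holds S A (ρ ∘ inj₂) e
      Π-holds {e} e∈ = holds-cong A (≈.sym A ∘ ρ≈ρ'x̄ȳ ∘ inj₂) e
        (holds-ren⁻ A ρ' (x̄ȳ ∘ inj₂) e
          (Cg-sound A A∈V ρ' (All.lookup (All-ren⁺ A ρ' x̄ȳ Γ (All-holds-cong A ρ≈ρ'x̄ȳ Γ Γ-holds))) (Π-in-B e∈)))

    Π-uniform : ∀ k (ε : Eqn S (Fin m ⊎ Fin k)) →
                renEqs S (inj₁ {B = Fin k}) Γ ⊨ (renEq S (yz↪ {n}) ε ∷ []) →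
                renEqs S (inj₁ {B = Fin k}) Π ⊨ (ε ∷ [])
    Π-uniform k (u , w) Γ⊨ε = Cg⇒⊨ (holds-var⁻ _ (injective k' k'u≈k'w))
      where
      A' C' : Algebra S
      A' = Presented (Fin m) (ListRel S Π)
      C' = Presented (Fin m ⊎ Fin k) (ListRel S (renEqs S inj₁ Π))

      i : Emb S A' B
      i = record { hom = Presented-map (x̄ȳ ∘ inj₂) Π-in-B ; injective = B-reflects-Π }

      j : Emb S A' C'
      j = record { hom = Presented-map inj₁ (cg-base ∘ ∈-map⁺ (renEq S inj₁))
                 ; injective = fresh-variables-conservative c Π }

      amalgam = AP A' B C' (Presented-InV _) (Presented-InV _) (Presented-InV _) i j
      D = proj₁ amalgam
      D∈V = proj₁ (proj₂ amalgam)
      h' = proj₁ (proj₂ (proj₂ amalgam))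
      k' = proj₁ (proj₂ (proj₂ (proj₂ amalgam)))
      h'i≈k'j = proj₂ (proj₂ (proj₂ (proj₂ amalgam)))

      ρ : Ctx n m k → Carrier D
      ρ = [ fun (hom h') ∘ var ∘ x̄ȳ , fun (hom k') ∘ var ∘ inj₂ ]

      Γ-holds : All (Holds S D ρ) (renEqs S inj₁ Γ)
      Γ-holds = All-ren⁺ D ρ inj₁ Γ (All-ren⁻ D (fun (hom h') ∘ var) x̄ȳ Γ
                  (All.map (λ {e} → holds-hom B D (hom h') var e) (relations-hold Γ')))

      ρ-on-ȳz̄ : ∀ x → _≈_ D (ρ (yz↪ {n} x)) (fun (hom k') (var x))
      ρ-on-ȳz̄ (inj₁ y) = h'i≈k'j (var y)
      ρ-on-ȳz̄ (inj₂ z) = ≈.refl D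

      k'u≈k'w : _≈_ D (fun (hom k') (eval S C' var u)) (fun (hom k') (eval S C' var w))
      k'u≈k'w = ≈.trans D (eval-hom C' D (hom k') var u)
        (≈.trans D (holds-cong D ρ-on-ȳz̄ (u , w) (holds-ren⁻ D ρ yz↪ (u , w) (All.head (Γ⊨ε D D∈V ρ Γ-holds))))
                   (≈.sym D (eval-hom C' D (hom k') var w)))

  amalgamation∧adjoints⇒deductive : HasConstant S → AmalgamationProperty → CompactLiftingsHaveRightAdjoints →
                                    RightUniformDeductiveInterpolation
  amalgamation∧adjoints⇒deductive c AP ADJ n m Γ = Π , Γ⊨Π , Π-uniform
    where open UniformInterpolant c AP ADJ Γ

theorem3p13 : (S : Signature) → HasConstant S → (E : Theory S) →
    let open Variety S E in
    (RightUniformMaeharaInterpolation ⇔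
       (RightUniformDeductiveInterpolation × CongruenceExtensionProperty))
    × ((RightUniformDeductiveInterpolation × CongruenceExtensionProperty) ⇔
       (AmalgamationProperty × CongruenceExtensionProperty × CompactLiftingsHaveRightAdjoints))
theorem3p13 S c E =
  mk⇔ (λ MI → maehara⇒deductive MI , maehara⇒cep MI)
      (λ (DI , CEP) → deductive∧cep⇒maehara DI CEP) ,
  mk⇔ (λ (DI , CEP) → maehara⇒amalgamation (deductive∧cep⇒maehara DI CEP) , CEP , deductive⇒adjoints DI)
      (λ (AP , CEP , ADJ) → amalgamation∧adjoints⇒deductive c AP ADJ , CEP)
  where
  open DeductiveAndMaehara S E
  open MaeharaToCongruenceExtension S E
  open MaeharaToAmalgamation S E
  open CompactLiftings S E
  open AmalgamationToInterpolation S E
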